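{- Let $d, r$ be positive integers. Every cube of length $r$ in $\mathbb{Z}^d$ has, contained in its convex hull, a basic cube of length $\lfloor r/d \rfloor$ (i.e., all points of some basic cube of length $\lfloor r/d \rfloor$ lie in the convex hull of the given cube).
   Context: For positive integers $d, r$, a cube of length $r$ in $\mathbb{Z}^d$ is a set of the form $\{a + i_1 v_1 + \cdots + i_d v_d : 0 \leq i_1,\dots,i_d \leq r \text{ integers}\}$ for some $a, v_1, \dots, v_d \in \mathbb{Z}^d$ with $\{v_1,\dots,v_d\}$ a basis of $\mathbb{R}^d$ over $\mathbb{R}$; it is a basic cube of length $r$ if moreover $\{v_1,\dots,v_d\}$ is a $\mathbb{Z}$-basis of $\mathbb{Z}^d$. -}

module Defs where

open import Data.Nat as ℕ using (ℕ; zero; suc)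
open import Data.Fin using (Fin; zero; suc)
open import Data.Integer as ℤ using (ℤ)
open import Data.Rational as ℚ using (ℚ; 0ℚ; 1ℚ)
open import Data.Product using (Σ; ∃; _×_)
open import Relation.Binary.PropositionalEquality using (_≡_)

Pt : ℕ → Set
Pt d = Fin d → ℤ

sumℤ : ∀ {n} → (Fin n → ℤ) → ℤ
sumℤ {zero}  f = ℤ.0ℤ
sumℤ {suc n} f = f zero ℤ.+ sumℤ (λ i → f (suc i))

sumℚ : ∀ {n} → (Fin n → ℚ) → ℚ
sumℚ {zero}  f = 0ℚ
sumℚ {suc n} f = f zero ℚ.+ sumℚ (λ i → f (suc i))

toℚ : ℤ → ℚ
toℚ z = z ℚ./ 1

cubePt : ∀ {d} → Pt d → (Fin d → Pt d) → (Fin d → ℕ) → Pt d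
cubePt a v i j = a j ℤ.+ sumℤ (λ k → ℤ.+ (i k) ℤ.* v k j)

-- v_1,...,v_d is a basis of ℝ^d over ℝ.  For d integer vectors in ℝ^d this
-- is linear independence; over ℝ this is equivalent to independence over ℚ
-- (rank of an integer matrix does not depend on the field), stated here over ℚ.
IsRBasis : ∀ {d} → (Fin d → Pt d) → Set
IsRBasis {d} v =
  (c : Fin d → ℚ) →
  (∀ j → sumℚ (λ k → c k ℚ.* toℚ (v k j)) ≡ 0ℚ) →
  ∀ k → c k ≡ 0ℚ

IsZBasis : ∀ {d} → (Fin d → Pt d) → Set
IsZBasis {d} v =
  ((c : Fin d → ℤ) → (∀ j → sumℤ (λ k → c k ℤ.* v k j) ≡ ℤ.0ℤ) → ∀ k → c k ≡ ℤ.0ℤ)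
  × ((p : Pt d) → Σ (Fin d → ℤ) λ c → ∀ j → sumℤ (λ k → c k ℤ.* v k j) ≡ p j)

InCube : ∀ {d} → Pt d → (Fin d → Pt d) → ℕ → Pt d → Set
InCube {d} a v r x =
  Σ (Fin d → ℕ) λ i → (∀ k → i k ℕ.≤ r) × (∀ j → cubePt a v i j ≡ x j)

InConvHull : ∀ {d} → (Pt d → Set) → Pt d → Set
InConvHull {d} S p =
  Σ ℕ λ n → Σ (Fin n → ℚ) λ λs → Σ (Fin n → Pt d) λ x →
    (∀ m → S (x m)) ×
    (∀ m → 0ℚ ℚ.≤ λs m) ×
    (sumℚ λs ≡ 1ℚ) ×
    (∀ j → sumℚ (λ m → λs m ℚ.* toℚ (x m j)) ≡ toℚ (p j))

{-# OPTIONS --safe #-}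
-- Write the edge vectors v₁ … v_d as the rows of an integer matrix v. Since they are linearly
-- independent, there are D > 0 and an integer matrix Z with Z v = v Z = D·1. Bring Z to Hermite
-- normal form H = U Z with U unimodular; because (v U⁻¹) H = D·1, every diagonal entry of H
-- divides D, so all entries of H lie in [0, D]. The rows w_k of U form a basis of ℤ^d and satisfy
-- D w_k = Σ_l H_kl v_l. Hence a point a + Σ_k ι_k w_k with 0 ≤ ι_k ≤ ⌊r/d⌋ equals a + Σ_l τ_l (r v_l)
-- with τ_l = (Σ_k ι_k H_kl) / (r D) ∈ [0, 1], and such points lie in the convex hull of the cube,
-- being iterated convex combinations of its vertices.
module Submission where

open import Defs
open import Data.Nat using (ℕ; _/_; _≤_; _<_; NonZero)
open import Data.Fin using (Fin)
open import Data.Product using (Σ; _×_)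

open import Data.Nat as ℕ using (zero; suc)
import Data.Nat.Properties as ℕP
import Data.Nat.DivMod as ℕD
open import Data.Nat.Induction using (<-wellFounded)
open import Data.Fin as Fin using (zero; suc; punchIn)
import Data.Fin.Properties as FinP
open import Data.Fin.Patterns using (0F; 1F)
open import Data.Integer as ℤ using (ℤ; +_; -[1+_]; +[1+_]; 0ℤ; 1ℤ; -1ℤ; _+_; _*_; -_; _-_)
import Data.Integer.Properties as ℤP
import Data.Integer.DivMod as ℤD
open import Data.Integer.Tactic.RingSolver using (solve-∀)
open import Data.Rational as ℚ using (ℚ; 0ℚ; 1ℚ; fromℚᵘ)
import Data.Rational.Properties as ℚP
import Data.Rational.Solver
open import Data.Rational.Unnormalised as ℚᵘ using (mkℚᵘ; *≡*; *≤*)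
import Data.Rational.Unnormalised.Properties as ℚᵘP
open import Data.Vec.Functional using (Vector; insertAt; removeAt; _++_) renaming (_∷_ to _◂_)
open import Data.Vec.Functional.Properties using (insertAt-lookup; insertAt-punchIn)
open import Data.Product using (_,_; proj₁; proj₂)
open import Data.Sum using (inj₁; inj₂)
import Data.Sum.Properties as SumP
open import Data.Unit using (⊤; tt)
open import Data.Empty using (⊥-elim)
open import Function using (_∘_)
open import Induction.WellFounded using (Acc; acc)
open import Relation.Nullary using (yes; no)
open import Relation.Binary.Bundles using (Setoid)
open import Relation.Binary.PropositionalEquality
import Relation.Binary.Reasoning.Setoid as SetoidReasoning
open import Algebra.Bundles using (Ring)
import Algebra.Properties.Semiring.Sum as SemiringSum
open import Algebra.Properties.AbelianGroup ℤP.+-0-abelianGroup using (inverseʳ-unique; ⁻¹-injective)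
open import Algebra.Properties.CommutativeSemigroup ℤP.*-commutativeSemigroup using (x∙yz≈y∙xz)
open import Algebra.Properties.CommutativeMonoid.Sum ℤP.*-1-commutativeMonoid
  using () renaming (sum to product; sum-remove to product-remove)
open SemiringSum ℤP.+-*-semiring
  using (sum; sum-cong-≗; ∑-distrib-+; ∑-comm; *-distribˡ-sum; *-distribʳ-sum; sum-replicate-zero; sum-remove)
module ∑ℚ = SemiringSum (Ring.semiring ℚP.+-*-ring)
open Data.Rational.Solver.+-*-Solver using (solve; _:+_; _:-_; _:*_; _:=_; con)

-- Integer matrices

sumℤ≡sum : ∀ {n} (f : Fin n → ℤ) → sumℤ f ≡ sum f
sumℤ≡sum {zero}  f = refl
sumℤ≡sum {suc n} f = cong (_+_ (f zero)) (sumℤ≡sum (f ∘ suc))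

sum-zero : ∀ {n} (f : Fin n → ℤ) → (∀ i → f i ≡ 0ℤ) → sum f ≡ 0ℤ
sum-zero {n} f f≗0 = trans (sum-cong-≗ f≗0) (sum-replicate-zero n)

Matrix : ℕ → ℕ → Set
Matrix m n = Fin m → Fin n → ℤ

0ᵥ : ∀ {n} → Vector ℤ n
0ᵥ _ = 0ℤ

infixl 7 _ᵥ*_ _*ᴹ_ _·ᴹ_
infix 4 _≋_

_ᵥ*_ : ∀ {m n} → Vector ℤ m → Matrix m n → Vector ℤ n
(c ᵥ* A) j = sum (λ k → c k * A k j)

_*ᴹ_ : ∀ {m n p} → Matrix m n → Matrix n p → Matrix m p
(A *ᴹ B) i = A i ᵥ* B

_·ᴹ_ : ∀ {m n} → ℤ → Matrix m n → Matrix m n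
(x ·ᴹ A) i j = x * A i j

1ᴹ : ∀ {n} → Matrix n n
1ᴹ zero    zero    = 1ℤ
1ᴹ zero    (suc j) = 0ℤ
1ᴹ (suc i) zero    = 0ℤ
1ᴹ (suc i) (suc j) = 1ᴹ i j

_≋_ : ∀ {m n} → Matrix m n → Matrix m n → Set
A ≋ B = ∀ i j → A i j ≡ B i j

≋-setoid : ℕ → ℕ → Setoid _ _
≋-setoid m n = record
  { Carrier       = Matrix m n
  ; _≈_           = _≋_
  ; isEquivalence = record
    { refl  = λ i j → refl
    ; sym   = λ A≋B i j → sym (A≋B i j)
    ; trans = λ A≋B B≋C i j → trans (A≋B i j) (B≋C i j)
    }
  }

ᵥ*-congˡ : ∀ {m n} {c c′ : Vector ℤ m} (A : Matrix m n) → c ≗ c′ → c ᵥ* A ≗ c′ ᵥ* A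
ᵥ*-congˡ A c≗c′ j = sum-cong-≗ (λ k → cong (_* A k j) (c≗c′ k))

ᵥ*-congʳ : ∀ {m n} (c : Vector ℤ m) {A B : Matrix m n} → A ≋ B → c ᵥ* A ≗ c ᵥ* B
ᵥ*-congʳ c A≋B j = sum-cong-≗ (λ k → cong (c k *_) (A≋B k j))

ᵥ*-zeroˡ : ∀ {m n} (A : Matrix m n) → 0ᵥ ᵥ* A ≗ 0ᵥ
ᵥ*-zeroˡ A j = sum-zero _ (λ k → ℤP.*-zeroˡ (A k j))

ᵥ*-zero-column : ∀ {m n} (c : Vector ℤ m) (A : Matrix m n) {j} → (∀ k → A k j ≡ 0ℤ) → (c ᵥ* A) j ≡ 0ℤ
ᵥ*-zero-column c A A₋ⱼ≡0 = sum-zero _ (λ k → trans (cong (c k *_) (A₋ⱼ≡0 k)) (ℤP.*-zeroʳ (c k)))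

ᵥ*-scaleˡ : ∀ {m n} (x : ℤ) (c : Vector ℤ m) (A : Matrix m n) → (λ k → x * c k) ᵥ* A ≗ λ j → x * (c ᵥ* A) j
ᵥ*-scaleˡ x c A j = begin
  sum (λ k → x * c k * A k j)   ≡⟨ sum-cong-≗ (λ k → ℤP.*-assoc x (c k) (A k j)) ⟩
  sum (λ k → x * (c k * A k j)) ≡⟨ *-distribˡ-sum x (λ k → c k * A k j) ⟨
  x * (c ᵥ* A) j                ∎
  where open ≡-Reasoning

ᵥ*-scaleʳ : ∀ {m n} (x : ℤ) (c : Vector ℤ m) (A : Matrix m n) → c ᵥ* (x ·ᴹ A) ≗ λ j → x * (c ᵥ* A) j
ᵥ*-scaleʳ x c A j = begin
  sum (λ k → c k * (x * A k j)) ≡⟨ sum-cong-≗ (λ k → x∙yz≈y∙xz (c k) x (A k j)) ⟩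
  sum (λ k → x * (c k * A k j)) ≡⟨ *-distribˡ-sum x (λ k → c k * A k j) ⟨
  x * (c ᵥ* A) j                ∎
  where open ≡-Reasoning

ᵥ*-distrib-+ : ∀ {m n} (c c′ : Vector ℤ m) (A : Matrix m n) →
               (λ k → c k + c′ k) ᵥ* A ≗ λ j → (c ᵥ* A) j + (c′ ᵥ* A) j
ᵥ*-distrib-+ c c′ A j = trans (sum-cong-≗ (λ k → ℤP.*-distribʳ-+ (A k j) (c k) (c′ k)))
                              (∑-distrib-+ (λ k → c k * A k j) (λ k → c′ k * A k j))

ᵥ*-neg : ∀ {m n} (c : Vector ℤ m) (A : Matrix m n) → (λ k → - c k) ᵥ* A ≗ λ j → - (c ᵥ* A) j
ᵥ*-neg c A j = begin
  ((λ k → - c k) ᵥ* A) j       ≡⟨ ᵥ*-congˡ A (λ k → sym (ℤP.-1*i≡-i (c k))) j ⟩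
  ((λ k → -1ℤ * c k) ᵥ* A) j   ≡⟨ ᵥ*-scaleˡ -1ℤ c A j ⟩
  -1ℤ * (c ᵥ* A) j             ≡⟨ ℤP.-1*i≡-i _ ⟩
  - (c ᵥ* A) j                 ∎
  where open ≡-Reasoning

ᵥ*-assoc : ∀ {m n p} (c : Vector ℤ m) (A : Matrix m n) (B : Matrix n p) → (c ᵥ* A) ᵥ* B ≗ c ᵥ* (A *ᴹ B)
ᵥ*-assoc c A B l = begin
  sum (λ j → sum (λ k → c k * A k j) * B j l)
    ≡⟨ sum-cong-≗ (λ j → *-distribʳ-sum (B j l) (λ k → c k * A k j)) ⟩
  sum (λ j → sum (λ k → c k * A k j * B j l))
    ≡⟨ ∑-comm (λ j k → c k * A k j * B j l) ⟩
  sum (λ k → sum (λ j → c k * A k j * B j l))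
    ≡⟨ sum-cong-≗ (λ k → sum-cong-≗ (λ j → ℤP.*-assoc (c k) (A k j) (B j l))) ⟩
  sum (λ k → sum (λ j → c k * (A k j * B j l)))
    ≡⟨ sum-cong-≗ (λ k → *-distribˡ-sum (c k) (λ j → A k j * B j l)) ⟨
  sum (λ k → c k * (A *ᴹ B) k l)
    ∎
  where open ≡-Reasoning

row-1ᴹ-ᵥ* : ∀ {m n} (i : Fin m) (A : Matrix m n) → 1ᴹ i ᵥ* A ≗ A i
row-1ᴹ-ᵥ* zero    A j = begin
  1ℤ * A zero j + sum (λ k → 0ℤ * A (suc k) j) ≡⟨ cong₂ _+_ (ℤP.*-identityˡ (A zero j)) (ᵥ*-zeroˡ (A ∘ suc) j) ⟩
  A zero j + 0ℤ                                ≡⟨ ℤP.+-identityʳ _ ⟩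
  A zero j                                     ∎
  where open ≡-Reasoning
row-1ᴹ-ᵥ* (suc i) A j = trans (ℤP.+-identityˡ _) (row-1ᴹ-ᵥ* i (A ∘ suc) j)

ᵥ*-identityʳ : ∀ {n} (c : Vector ℤ n) → c ᵥ* 1ᴹ ≗ c
ᵥ*-identityʳ c zero    = begin
  c zero * 1ℤ + sum (λ k → c (suc k) * 0ℤ) ≡⟨ cong₂ _+_ (ℤP.*-identityʳ (c zero))
                                                         (sum-zero _ (λ k → ℤP.*-zeroʳ (c (suc k)))) ⟩
  c zero + 0ℤ                              ≡⟨ ℤP.+-identityʳ _ ⟩
  c zero                                   ∎
  where open ≡-Reasoning
ᵥ*-identityʳ c (suc j) = begin
  c zero * 0ℤ + ((c ∘ suc) ᵥ* 1ᴹ) j ≡⟨ cong (_+ ((c ∘ suc) ᵥ* 1ᴹ) j) (ℤP.*-zeroʳ (c zero)) ⟩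
  0ℤ + ((c ∘ suc) ᵥ* 1ᴹ) j          ≡⟨ ℤP.+-identityˡ _ ⟩
  ((c ∘ suc) ᵥ* 1ᴹ) j               ≡⟨ ᵥ*-identityʳ (c ∘ suc) j ⟩
  c (suc j)                         ∎
  where open ≡-Reasoning

*ᴹ-assoc : ∀ {m n p q} (A : Matrix m n) (B : Matrix n p) (C : Matrix p q) → (A *ᴹ B) *ᴹ C ≋ A *ᴹ (B *ᴹ C)
*ᴹ-assoc A B C i = ᵥ*-assoc (A i) B C

*ᴹ-identityˡ : ∀ {m n} (A : Matrix m n) → 1ᴹ *ᴹ A ≋ A
*ᴹ-identityˡ A i = row-1ᴹ-ᵥ* i A

*ᴹ-congˡ : ∀ {m n p} {A A′ : Matrix m n} (B : Matrix n p) → A ≋ A′ → A *ᴹ B ≋ A′ *ᴹ B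
*ᴹ-congˡ B A≋A′ i = ᵥ*-congˡ B (A≋A′ i)

*ᴹ-congʳ : ∀ {m n p} (A : Matrix m n) {B B′ : Matrix n p} → B ≋ B′ → A *ᴹ B ≋ A *ᴹ B′
*ᴹ-congʳ A B≋B′ i = ᵥ*-congʳ (A i) B≋B′

scalarᴹ : ∀ {n} → ℤ → Matrix n n
scalarᴹ x = x ·ᴹ 1ᴹ

scalarᴹ-*ᴹ : ∀ {m n} (x : ℤ) (A : Matrix m n) → scalarᴹ x *ᴹ A ≋ x ·ᴹ A
scalarᴹ-*ᴹ x A i j = trans (ᵥ*-scaleˡ x (1ᴹ i) A j) (cong (x *_) (row-1ᴹ-ᵥ* i A j))

*ᴹ-scalarᴹ : ∀ {m n} (x : ℤ) (A : Matrix m n) → A *ᴹ scalarᴹ x ≋ x ·ᴹ A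
*ᴹ-scalarᴹ x A i j = trans (ᵥ*-scaleʳ x (A i) 1ᴹ j) (cong (x *_) (ᵥ*-identityʳ (A i) j))

Unimodular : ∀ {n} → Matrix n n → Set
Unimodular {n} U = Σ (Matrix n n) λ V → U *ᴹ V ≋ 1ᴹ × V *ᴹ U ≋ 1ᴹ

1ᴹ-unimodular : ∀ {n} → Unimodular {n} 1ᴹ
1ᴹ-unimodular = 1ᴹ , *ᴹ-identityˡ 1ᴹ , *ᴹ-identityˡ 1ᴹ

*ᴹ-unimodular : ∀ {n} {U V : Matrix n n} → Unimodular U → Unimodular V → Unimodular (U *ᴹ V)
*ᴹ-unimodular {n} {U} {V} (U⁻¹ , UU⁻¹≋1 , U⁻¹U≋1) (V⁻¹ , VV⁻¹≋1 , V⁻¹V≋1) =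
  V⁻¹ *ᴹ U⁻¹ , cancel U V U⁻¹ V⁻¹ VV⁻¹≋1 UU⁻¹≋1 , cancel V⁻¹ U⁻¹ V U U⁻¹U≋1 V⁻¹V≋1
  where
  cancel : (A B A′ B′ : Matrix n n) → B *ᴹ B′ ≋ 1ᴹ → A *ᴹ A′ ≋ 1ᴹ → (A *ᴹ B) *ᴹ (B′ *ᴹ A′) ≋ 1ᴹ
  cancel A B A′ B′ BB′≋1 AA′≋1 = begin
    (A *ᴹ B) *ᴹ (B′ *ᴹ A′) ≈⟨ *ᴹ-assoc A B (B′ *ᴹ A′) ⟩
    A *ᴹ (B *ᴹ (B′ *ᴹ A′)) ≈⟨ *ᴹ-congʳ A (*ᴹ-assoc B B′ A′) ⟨
    A *ᴹ ((B *ᴹ B′) *ᴹ A′) ≈⟨ *ᴹ-congʳ A (*ᴹ-congˡ A′ BB′≋1) ⟩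
    A *ᴹ (1ᴹ *ᴹ A′)        ≈⟨ *ᴹ-congʳ A (*ᴹ-identityˡ A′) ⟩
    A *ᴹ A′                ≈⟨ AA′≋1 ⟩
    1ᴹ                     ∎
    where open SetoidReasoning (≋-setoid n n)

scalarᴹ-unimodular : ∀ {n} (x y : ℤ) → x * y ≡ 1ℤ → Unimodular {n} (scalarᴹ x)
scalarᴹ-unimodular x y xy≡1 = scalarᴹ y , inverse x y xy≡1 , inverse y x (trans (ℤP.*-comm y x) xy≡1)
  where
  inverse : ∀ x y → x * y ≡ 1ℤ → scalarᴹ x *ᴹ scalarᴹ y ≋ 1ᴹ
  inverse x y xy≡1 i j = begin
    (scalarᴹ x *ᴹ scalarᴹ y) i j ≡⟨ scalarᴹ-*ᴹ x (scalarᴹ y) i j ⟩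
    x * (y * 1ᴹ i j)             ≡⟨ ℤP.*-assoc x y (1ᴹ i j) ⟨
    x * y * 1ᴹ i j               ≡⟨ cong (_* 1ᴹ i j) xy≡1 ⟩
    1ℤ * 1ᴹ i j                  ≡⟨ ℤP.*-identityˡ (1ᴹ i j) ⟩
    1ᴹ i j                       ∎
    where open ≡-Reasoning

block : ∀ {m n} → ℤ → Vector ℤ n → Vector ℤ m → Matrix m n → Matrix (suc m) (suc n)
block a r c N zero    zero    = a
block a r c N zero    (suc l) = r l
block a r c N (suc k) zero    = c k
block a r c N (suc k) (suc l) = N k l

minor : ∀ {m n} → Matrix (suc m) (suc n) → Matrix m n
minor M i j = M (suc i) (suc j)

1⊕_ : ∀ {n} → Matrix n n → Matrix (suc n) (suc n)
1⊕ U = block 1ℤ 0ᵥ 0ᵥ U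

1⊕-*ᴹ-zero : ∀ {m n} (U : Matrix m m) (X : Matrix (suc m) n) → ((1⊕ U) *ᴹ X) zero ≗ X zero
1⊕-*ᴹ-zero U X j = begin
  1ℤ * X zero j + (0ᵥ ᵥ* (X ∘ suc)) j ≡⟨ cong₂ _+_ (ℤP.*-identityˡ (X zero j)) (ᵥ*-zeroˡ (X ∘ suc) j) ⟩
  X zero j + 0ℤ                       ≡⟨ ℤP.+-identityʳ (X zero j) ⟩
  X zero j                            ∎
  where open ≡-Reasoning

1⊕-*ᴹ-suc : ∀ {m n} (U : Matrix m m) (X : Matrix (suc m) n) k → ((1⊕ U) *ᴹ X) (suc k) ≗ (U *ᴹ (X ∘ suc)) k
1⊕-*ᴹ-suc U X k j = begin
  0ℤ * X zero j + (U *ᴹ (X ∘ suc)) k j ≡⟨ cong (_+ (U *ᴹ (X ∘ suc)) k j) (ℤP.*-zeroˡ (X zero j)) ⟩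
  0ℤ + (U *ᴹ (X ∘ suc)) k j            ≡⟨ ℤP.+-identityˡ _ ⟩
  (U *ᴹ (X ∘ suc)) k j                 ∎
  where open ≡-Reasoning

1⊕-*ᴹ-block : ∀ {n} (U H : Matrix n n) (M : Matrix (suc n) (suc n)) → (∀ k → M (suc k) zero ≡ 0ℤ) →
              H ≋ U *ᴹ minor M → (1⊕ U) *ᴹ M ≋ block (M zero zero) (λ l → M zero (suc l)) 0ᵥ H
1⊕-*ᴹ-block U H M below H≋UM zero    zero    = 1⊕-*ᴹ-zero U M zero
1⊕-*ᴹ-block U H M below H≋UM zero    (suc l) = 1⊕-*ᴹ-zero U M (suc l)
1⊕-*ᴹ-block U H M below H≋UM (suc k) zero    = trans (1⊕-*ᴹ-suc U M k zero) (ᵥ*-zero-column (U k) (M ∘ suc) below)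
1⊕-*ᴹ-block U H M below H≋UM (suc k) (suc l) = trans (1⊕-*ᴹ-suc U M k (suc l)) (sym (H≋UM k l))

1⊕-unimodular : ∀ {n} {U : Matrix n n} → Unimodular U → Unimodular (1⊕ U)
1⊕-unimodular {n} {U} (U⁻¹ , UU⁻¹≋1 , U⁻¹U≋1) = 1⊕ U⁻¹ , lift U U⁻¹ UU⁻¹≋1 , lift U⁻¹ U U⁻¹U≋1
  where
  lift : (A B : Matrix n n) → A *ᴹ B ≋ 1ᴹ → (1⊕ A) *ᴹ (1⊕ B) ≋ 1ᴹ
  lift A B AB≋1 zero    zero    = 1⊕-*ᴹ-zero A (1⊕ B) zero
  lift A B AB≋1 zero    (suc l) = 1⊕-*ᴹ-zero A (1⊕ B) (suc l)
  lift A B AB≋1 (suc k) zero    = trans (1⊕-*ᴹ-suc A (1⊕ B) k zero)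
                                        (ᵥ*-zero-column (A k) ((1⊕ B) ∘ suc) {zero} (λ _ → refl))
  lift A B AB≋1 (suc k) (suc l) = trans (1⊕-*ᴹ-suc A (1⊕ B) k (suc l)) (AB≋1 k l)

shear : ∀ {n} → Vector ℤ n → Matrix (suc n) (suc n)
shear q = block 1ℤ q 0ᵥ 1ᴹ

shear-*ᴹ-zero : ∀ {m n} (q : Vector ℤ m) (X : Matrix (suc m) n) →
                (shear q *ᴹ X) zero ≗ λ j → X zero j + (q ᵥ* (X ∘ suc)) j
shear-*ᴹ-zero q X j = cong (_+ (q ᵥ* (X ∘ suc)) j) (ℤP.*-identityˡ (X zero j))

shear-*ᴹ-suc : ∀ {m n} (q : Vector ℤ m) (X : Matrix (suc m) n) k → (shear q *ᴹ X) (suc k) ≗ X (suc k)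
shear-*ᴹ-suc q X k j = trans (1⊕-*ᴹ-suc 1ᴹ X k j) (row-1ᴹ-ᵥ* k (X ∘ suc) j)

shear-*ᴹ-block : ∀ {m n} (q : Vector ℤ m) (a : ℤ) (r : Vector ℤ n) (N : Matrix m n) →
                 shear q *ᴹ block a r 0ᵥ N ≋ block a (λ l → r l + (q ᵥ* N) l) 0ᵥ N
shear-*ᴹ-block q a r N zero    zero    = begin
  (shear q *ᴹ X) zero zero  ≡⟨ shear-*ᴹ-zero q X zero ⟩
  a + (q ᵥ* (X ∘ suc)) zero ≡⟨ cong (_+_ a) (ᵥ*-zero-column q (X ∘ suc) {zero} (λ _ → refl)) ⟩
  a + 0ℤ                    ≡⟨ ℤP.+-identityʳ a ⟩
  a                         ∎
  where
  open ≡-Reasoning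
  X = block a r 0ᵥ N
shear-*ᴹ-block q a r N zero    (suc l) = shear-*ᴹ-zero q (block a r 0ᵥ N) (suc l)
shear-*ᴹ-block q a r N (suc k) zero    = shear-*ᴹ-suc q (block a r 0ᵥ N) k zero
shear-*ᴹ-block q a r N (suc k) (suc l) = shear-*ᴹ-suc q (block a r 0ᵥ N) k (suc l)

shear-unimodular : ∀ {n} (q : Vector ℤ n) → Unimodular (shear q)
shear-unimodular {n} q = shear (-_ ∘ q) , cancel q (-_ ∘ q) (λ l → ℤP.+-inverseˡ (q l)) ,
                                          cancel (-_ ∘ q) q (λ l → ℤP.+-inverseʳ (q l))
  where
  cancel : (q q′ : Vector ℤ n) → (∀ l → q′ l + q l ≡ 0ℤ) → shear q *ᴹ shear q′ ≋ 1ᴹ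
  cancel q q′ q′+q≡0 i j = trans (shear-*ᴹ-block q 1ℤ q′ 1ᴹ i j) (entries i j)
    where
    entries : block 1ℤ (λ l → q′ l + (q ᵥ* 1ᴹ) l) 0ᵥ 1ᴹ ≋ 1ᴹ
    entries zero    zero    = refl
    entries zero    (suc l) = trans (cong (_+_ (q′ l)) (ᵥ*-identityʳ q l)) (q′+q≡0 l)
    entries (suc k) zero    = refl
    entries (suc k) (suc l) = refl

mat₂ : ℤ → ℤ → ℤ → ℤ → Matrix 2 2
mat₂ a b c d 0F 0F = a
mat₂ a b c d 0F 1F = b
mat₂ a b c d 1F 0F = c
mat₂ a b c d 1F 1F = d

mat₂-unimodular : ∀ {a b c d} → a * d - b * c ≡ 1ℤ → Unimodular (mat₂ a b c d)
mat₂-unimodular {a} {b} {c} {d} det = mat₂ d (- b) (- c) a , right , left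
  where
  expand₁ : ∀ a b c d → a * d + (b * - c + 0ℤ) ≡ a * d - b * c
  expand₁ = solve-∀
  expand₂ : ∀ a b c d → c * - b + (d * a + 0ℤ) ≡ a * d - b * c
  expand₂ = solve-∀
  expand₃ : ∀ a b c d → d * a + (- b * c + 0ℤ) ≡ a * d - b * c
  expand₃ = solve-∀
  expand₄ : ∀ a b c d → - c * b + (a * d + 0ℤ) ≡ a * d - b * c
  expand₄ = solve-∀
  cancel₁ : ∀ x y → x * - y + (y * x + 0ℤ) ≡ 0ℤ
  cancel₁ = solve-∀
  cancel₂ : ∀ x y → x * y + (y * - x + 0ℤ) ≡ 0ℤ
  cancel₂ = solve-∀
  cancel₃ : ∀ x y → x * y + (- y * x + 0ℤ) ≡ 0ℤ
  cancel₃ = solve-∀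
  cancel₄ : ∀ x y → - x * y + (y * x + 0ℤ) ≡ 0ℤ
  cancel₄ = solve-∀
  right : mat₂ a b c d *ᴹ mat₂ d (- b) (- c) a ≋ 1ᴹ
  right 0F 0F = trans (expand₁ a b c d) det
  right 0F 1F = cancel₁ a b
  right 1F 0F = cancel₂ c d
  right 1F 1F = trans (expand₂ a b c d) det
  left : mat₂ d (- b) (- c) a *ᴹ mat₂ a b c d ≋ 1ᴹ
  left 0F 0F = trans (expand₃ a b c d) det
  left 0F 1F = cancel₃ d b
  left 1F 0F = cancel₄ c a
  left 1F 1F = trans (expand₄ a b c d) det

embed₂ : ∀ {n} → Matrix 2 2 → Matrix (2 ℕ.+ n) (2 ℕ.+ n)
embed₂ P = block (P 0F 0F) (P 0F 1F ◂ 0ᵥ) (P 1F 0F ◂ 0ᵥ) (block (P 1F 1F) 0ᵥ 0ᵥ 1ᴹ)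

top₂ : ∀ {m n} → Matrix (2 ℕ.+ m) n → Matrix 2 n
top₂ X 0F = X 0F
top₂ X 1F = X 1F

embed₂-*ᴹ-0F : ∀ {m n} (P : Matrix 2 2) (X : Matrix (2 ℕ.+ m) n) → (embed₂ P *ᴹ X) 0F ≗ (P *ᴹ top₂ X) 0F
embed₂-*ᴹ-0F P X j = cong (λ z → P 0F 0F * X 0F j + (P 0F 1F * X 1F j + z)) (ᵥ*-zeroˡ (λ i → X (suc (suc i))) j)

embed₂-*ᴹ-1F : ∀ {m n} (P : Matrix 2 2) (X : Matrix (2 ℕ.+ m) n) → (embed₂ P *ᴹ X) 1F ≗ (P *ᴹ top₂ X) 1F
embed₂-*ᴹ-1F P X j = cong (λ z → P 1F 0F * X 0F j + (P 1F 1F * X 1F j + z)) (ᵥ*-zeroˡ (λ i → X (suc (suc i))) j)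

embed₂-*ᴹ-rest : ∀ {m n} (P : Matrix 2 2) (X : Matrix (2 ℕ.+ m) n) k →
                 (embed₂ P *ᴹ X) (suc (suc k)) ≗ X (suc (suc k))
embed₂-*ᴹ-rest P X k j = begin
  0ℤ * X 0F j + (0ℤ * X 1F j + (1ᴹ k ᵥ* X₂) j) ≡⟨ cong₂ (λ x y → x + (y + (1ᴹ k ᵥ* X₂) j))
                                                         (ℤP.*-zeroˡ (X 0F j)) (ℤP.*-zeroˡ (X 1F j)) ⟩
  0ℤ + (0ℤ + (1ᴹ k ᵥ* X₂) j)                   ≡⟨ trans (ℤP.+-identityˡ _) (ℤP.+-identityˡ _) ⟩
  (1ᴹ k ᵥ* X₂) j                               ≡⟨ row-1ᴹ-ᵥ* k X₂ j ⟩
  X (suc (suc k)) j                            ∎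
  where
  open ≡-Reasoning
  X₂ = λ i → X (suc (suc i))

embed₂-inverse : ∀ {n} (P Q : Matrix 2 2) → P *ᴹ Q ≋ 1ᴹ → embed₂ {n} P *ᴹ embed₂ Q ≋ 1ᴹ
embed₂-inverse {n} P Q PQ≋1 = inverse
  where
  no-overlap : ∀ x y → x * 0ℤ + (y * 0ℤ + 0ℤ) ≡ 0ℤ
  no-overlap = solve-∀
  Q′ = embed₂ {n} Q
  inverse : embed₂ P *ᴹ Q′ ≋ 1ᴹ
  inverse 0F            0F            = trans (embed₂-*ᴹ-0F P Q′ 0F) (PQ≋1 0F 0F)
  inverse 0F            1F            = trans (embed₂-*ᴹ-0F P Q′ 1F) (PQ≋1 0F 1F)
  inverse 0F            (suc (suc l)) = trans (embed₂-*ᴹ-0F P Q′ (suc (suc l))) (no-overlap (P 0F 0F) (P 0F 1F))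
  inverse 1F            0F            = trans (embed₂-*ᴹ-1F P Q′ 0F) (PQ≋1 1F 0F)
  inverse 1F            1F            = trans (embed₂-*ᴹ-1F P Q′ 1F) (PQ≋1 1F 1F)
  inverse 1F            (suc (suc l)) = trans (embed₂-*ᴹ-1F P Q′ (suc (suc l))) (no-overlap (P 1F 0F) (P 1F 1F))
  inverse (suc (suc k)) 0F            = embed₂-*ᴹ-rest P Q′ k 0F
  inverse (suc (suc k)) 1F            = embed₂-*ᴹ-rest P Q′ k 1F
  inverse (suc (suc k)) (suc (suc l)) = embed₂-*ᴹ-rest P Q′ k (suc (suc l))

embed₂-unimodular : ∀ {n} (P : Matrix 2 2) → Unimodular P → Unimodular (embed₂ {n} P)
embed₂-unimodular P (P⁻¹ , PP⁻¹≋1 , P⁻¹P≋1) = embed₂ P⁻¹ , embed₂-inverse P P⁻¹ PP⁻¹≋1 , embed₂-inverse P⁻¹ P P⁻¹P≋1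

-- Hermite normal form

ClearsSecond : ℤ → ℤ → Set
ClearsSecond a b = Σ (Matrix 2 2) λ P → Unimodular P × P 1F 0F * a + P 1F 1F * b ≡ 0ℤ

clear-second : ∀ a b → Acc ℕ._<_ ℤ.∣ b ∣ → ClearsSecond a b
clear-second-step : ∀ a b .{{_ : ℤ.NonZero b}} → (∀ {m} → m ℕ.< ℤ.∣ b ∣ → Acc ℕ._<_ m) → ClearsSecond a b

clear-second a (+ 0)        _           = 1ᴹ , 1ᴹ-unimodular , ℤP.+-identityʳ (0ℤ * a)
clear-second a b@(+[1+ _ ]) (acc below) = clear-second-step a b below
clear-second a b@(-[1+ _ ]) (acc below) = clear-second-step a b below

-- Euclid's algorithm: S sends (a, b) to (b, - (a mod b)).
clear-second-step a b below = P *ᴹ S , *ᴹ-unimodular {U = P} {V = S} P-unimodular (mat₂-unimodular (det q)) , clears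
  where
  q = a ℤD./ b
  r = + (a ℤD.% b)
  S = mat₂ 0ℤ 1ℤ -1ℤ q
  r<∣b∣ : ℤ.∣ - r ∣ ℕ.< ℤ.∣ b ∣
  r<∣b∣ = subst (ℕ._< ℤ.∣ b ∣) (sym (ℤP.∣-i∣≡∣i∣ r)) (ℤD.n%d<d a b)
  recursion = clear-second b (- r) (below r<∣b∣)
  P = proj₁ recursion
  P-unimodular = proj₁ (proj₂ recursion)
  det : ∀ q → 0ℤ * q - 1ℤ * -1ℤ ≡ 1ℤ
  det = solve-∀
  step : ∀ x y q b r → (x * 0ℤ + (y * -1ℤ + 0ℤ)) * (r + q * b) + (x * 1ℤ + (y * q + 0ℤ)) * b ≡ x * b + y * - r
  step = solve-∀
  clears : (P *ᴹ S) 1F 0F * a + (P *ᴹ S) 1F 1F * b ≡ 0ℤ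
  clears = begin
    (P *ᴹ S) 1F 0F * a + (P *ᴹ S) 1F 1F * b             ≡⟨ cong (λ a′ → (P *ᴹ S) 1F 0F * a′ + (P *ᴹ S) 1F 1F * b)
                                                                 (ℤD.a≡a%n+[a/n]*n a b) ⟩
    (P *ᴹ S) 1F 0F * (r + q * b) + (P *ᴹ S) 1F 1F * b   ≡⟨ step (P 1F 0F) (P 1F 1F) q b r ⟩
    P 1F 0F * b + P 1F 1F * - r                         ≡⟨ proj₂ (proj₂ recursion) ⟩
    0ℤ                                                  ∎
    where open ≡-Reasoning

clear-below : ∀ {m n} (M : Matrix (suc m) (suc n)) →
              Σ (Matrix (suc m) (suc m)) λ E → Unimodular E × ∀ k → (E *ᴹ M) (suc k) zero ≡ 0ℤ
clear-below {zero}  M = 1ᴹ , 1ᴹ-unimodular , λ ()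
clear-below {suc m} M with clear-below (M ∘ suc)
... | E , E-unimodular , E-clears with clear-second (((1⊕ E) *ᴹ M) 0F 0F) (((1⊕ E) *ᴹ M) 1F 0F) (<-wellFounded _)
... | P , P-unimodular , P-clears =
  embed₂ P *ᴹ (1⊕ E) ,
  *ᴹ-unimodular {U = embed₂ P} {V = 1⊕ E} (embed₂-unimodular P P-unimodular) (1⊕-unimodular {U = E} E-unimodular) ,
  λ k → trans (*ᴹ-assoc (embed₂ P) (1⊕ E) M (suc k) 0F) (clears k)
  where
  X = (1⊕ E) *ᴹ M
  clears : ∀ k → (embed₂ P *ᴹ X) (suc k) zero ≡ 0ℤ
  clears zero    = trans (embed₂-*ᴹ-1F P X 0F) (trans (cong (_+_ (P 1F 0F * X 0F 0F)) (ℤP.+-identityʳ _)) P-clears)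
  clears (suc k) = trans (embed₂-*ᴹ-rest P X k 0F) (trans (1⊕-*ᴹ-suc E M (suc k) 0F) (E-clears k))

FirstColumnReduced : ∀ {m n} → Matrix (suc m) (suc n) → Set
FirstColumnReduced M = 0ℤ ℤ.≤ M zero zero × (∀ k → M (suc k) zero ≡ 0ℤ)

sign-normaliser : ∀ x → Σ ℤ λ s → s * s ≡ 1ℤ × 0ℤ ℤ.≤ s * x
sign-normaliser (+ n)    = 1ℤ , refl , subst (0ℤ ℤ.≤_) (sym (ℤP.*-identityˡ (+ n))) (ℤ.+≤+ ℕ.z≤n)
sign-normaliser -[1+ n ] = -1ℤ , refl , ℤ.+≤+ ℕ.z≤n

reduce-first-column : ∀ {m n} (M : Matrix (suc m) (suc n)) →
                      Σ (Matrix (suc m) (suc m)) λ E → Unimodular E × FirstColumnReduced (E *ᴹ M)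
reduce-first-column M with clear-below M
... | E , E-unimodular , E-clears with sign-normaliser ((E *ᴹ M) 0F 0F)
... | s , s²≡1 , 0≤s*g =
  scalarᴹ s *ᴹ E , *ᴹ-unimodular {U = scalarᴹ s} {V = E} (scalarᴹ-unimodular s s s²≡1) E-unimodular ,
  subst (0ℤ ℤ.≤_) (sym (scaled 0F 0F)) 0≤s*g ,
  λ k → trans (scaled (suc k) 0F) (trans (cong (s *_) (E-clears k)) (ℤP.*-zeroʳ s))
  where
  scaled : (scalarᴹ s *ᴹ E) *ᴹ M ≋ s ·ᴹ (E *ᴹ M)
  scaled i j = trans (*ᴹ-assoc (scalarᴹ s) E M i j) (scalarᴹ-*ᴹ s (E *ᴹ M) i j)

IsHermite : ∀ {n} → Matrix n n → Set
IsHermite {zero}  H = ⊤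
IsHermite {suc n} H = 0ℤ ℤ.< H zero zero × (∀ k → H (suc k) zero ≡ 0ℤ) ×
                      (∀ l → 0ℤ ℤ.≤ H zero (suc l) × H zero (suc l) ℤ.< H (suc l) (suc l)) × IsHermite (minor H)

hermite-entry-bounds : ∀ {n} (H : Matrix n n) → IsHermite H → ∀ k l → 0ℤ ℤ.≤ H k l × H k l ℤ.≤ H l l
hermite-entry-bounds H (0<h , below , above , hermite) zero    zero    = ℤP.<⇒≤ 0<h , ℤP.≤-refl
hermite-entry-bounds H (0<h , below , above , hermite) zero    (suc l) = proj₁ (above l) , ℤP.<⇒≤ (proj₂ (above l))
hermite-entry-bounds H (0<h , below , above , hermite) (suc k) zero    =
  subst (λ z → 0ℤ ℤ.≤ z × z ℤ.≤ H zero zero) (sym (below k)) (ℤP.≤-refl , ℤP.<⇒≤ 0<h)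
hermite-entry-bounds H (0<h , below , above , hermite) (suc k) (suc l) = hermite-entry-bounds (minor H) hermite k l

euclidean-remainder : ∀ x h → 0ℤ ℤ.< h → Σ ℤ λ q → 0ℤ ℤ.≤ x + q * h × x + q * h ℤ.< h
euclidean-remainder x h 0<h =
  - (x ℤD./ h) , subst (0ℤ ℤ.≤_) (sym x-qh≡r) (ℤ.+≤+ ℕ.z≤n) ,
  subst₂ ℤ._<_ (sym x-qh≡r) (ℤP.0≤i⇒+∣i∣≡i (ℤP.<⇒≤ 0<h)) (ℤ.+<+ (ℤD.n%d<d x h))
  where
  instance
    _ : ℤ.NonZero h
    _ = ℤ.>-nonZero 0<h
  cancel : ∀ r q h → r + q * h + - q * h ≡ r
  cancel = solve-∀
  x-qh≡r : x + - (x ℤD./ h) * h ≡ + (x ℤD.% h)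
  x-qh≡r = trans (cong (λ x′ → x′ + - (x ℤD./ h) * h) (ℤD.a≡a%n+[a/n]*n x h)) (cancel (+ (x ℤD.% h)) (x ℤD./ h) h)

reduce-mod-hermite : ∀ {n} (H : Matrix n n) → IsHermite H → (r : Vector ℤ n) →
                     Σ (Vector ℤ n) λ q → ∀ l → 0ℤ ℤ.≤ r l + (q ᵥ* H) l × r l + (q ᵥ* H) l ℤ.< H l l
reduce-mod-hermite {zero}  H _ r = 0ᵥ , λ ()
reduce-mod-hermite {suc n} H (0<h , below , _ , hermite) r with euclidean-remainder (r zero) (H zero zero) 0<h
... | q₀ , q₀-reduces with reduce-mod-hermite (minor H) hermite (λ l → r (suc l) + q₀ * H zero (suc l))
... | q′ , q′-reduces = q₀ ◂ q′ , reduces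
  where
  reduces : ∀ l → 0ℤ ℤ.≤ r l + ((q₀ ◂ q′) ᵥ* H) l × r l + ((q₀ ◂ q′) ᵥ* H) l ℤ.< H l l
  reduces zero    = subst (λ z → 0ℤ ℤ.≤ z × z ℤ.< H zero zero) (sym first) q₀-reduces
    where
    first : r zero + ((q₀ ◂ q′) ᵥ* H) zero ≡ r zero + q₀ * H zero zero
    first = cong (_+_ (r zero)) (trans (cong (_+_ (q₀ * H zero zero)) (ᵥ*-zero-column q′ (H ∘ suc) below))
                                       (ℤP.+-identityʳ _))
  reduces (suc l) = subst (λ z → 0ℤ ℤ.≤ z × z ℤ.< H (suc l) (suc l)) (ℤP.+-assoc (r (suc l)) _ _) (q′-reduces l)

record HermiteForm {n} (D : ℕ) (M : Matrix n n) : Set where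
  field
    U            : Matrix n n
    U-unimodular : Unimodular U
    H            : Matrix n n
    H≋U*M        : H ≋ U *ᴹ M
    H-hermite    : IsHermite H
    H-diagonal≤D : ∀ k → H k k ℤ.≤ + D

hermite-form-absorbˡ : ∀ {n D} {E M : Matrix n n} → Unimodular E → HermiteForm D (E *ᴹ M) → HermiteForm D M
hermite-form-absorbˡ {E = E} {M} E-unimodular F = record
  { U            = U *ᴹ E
  ; U-unimodular = *ᴹ-unimodular {U = U} {V = E} U-unimodular E-unimodular
  ; H            = H
  ; H≋U*M        = λ i j → trans (H≋U*M i j) (sym (*ᴹ-assoc U E M i j))
  ; H-hermite    = H-hermite
  ; H-diagonal≤D = H-diagonal≤D
  }
  where open HermiteForm F

hermite-extend : ∀ {n} (D : ℕ) (M : Matrix (suc n) (suc n)) → (∀ k → M (suc k) zero ≡ 0ℤ) →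
                 0ℤ ℤ.< M zero zero → M zero zero ℤ.≤ + D → HermiteForm D (minor M) → HermiteForm D M
hermite-extend {n} D M below 0<g g≤D F
  with reduce-mod-hermite (HermiteForm.H F) (HermiteForm.H-hermite F) (M zero ∘ suc)
... | q , q-reduces = record
  { U            = shear q *ᴹ (1⊕ U)
  ; U-unimodular = *ᴹ-unimodular {U = shear q} {V = 1⊕ U} (shear-unimodular q) (1⊕-unimodular {U = U} U-unimodular)
  ; H            = H′
  ; H≋U*M        = H′≋U′*M
  ; H-hermite    = 0<g , (λ _ → refl) , q-reduces , H-hermite
  ; H-diagonal≤D = λ { zero → g≤D ; (suc k) → H-diagonal≤D k }
  }
  where
  open HermiteForm F
  H′ = block (M zero zero) (λ l → M zero (suc l) + (q ᵥ* H) l) 0ᵥ H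
  H′≋U′*M : H′ ≋ (shear q *ᴹ (1⊕ U)) *ᴹ M
  H′≋U′*M = begin
    H′                                               ≈⟨ shear-*ᴹ-block q (M zero zero) (M zero ∘ suc) H ⟨
    shear q *ᴹ block (M zero zero) (M zero ∘ suc) 0ᵥ H ≈⟨ *ᴹ-congʳ (shear q) (1⊕-*ᴹ-block U H M below H≋U*M) ⟨
    shear q *ᴹ ((1⊕ U) *ᴹ M)                         ≈⟨ *ᴹ-assoc (shear q) (1⊕ U) M ⟨
    (shear q *ᴹ (1⊕ U)) *ᴹ M                         ∎
    where open SetoidReasoning (≋-setoid (suc n) (suc n))

divisor-bound : ∀ {b g} (D : ℕ) .{{_ : NonZero D}} → 0ℤ ℤ.≤ g → b * g ≡ + D → 0ℤ ℤ.< g × g ℤ.≤ + D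
divisor-bound {b} {+ 0}      D _ bg≡D = ⊥-elim (ℕ.≢-nonZero⁻¹ D (ℤP.+-injective (trans (sym bg≡D) (ℤP.*-zeroʳ b))))
divisor-bound {b} {+[1+ k ]} D _ bg≡D =
  ℤ.+<+ (ℕ.s≤s ℕ.z≤n) , ℤ.+≤+ (subst (suc k ℕ.≤_) ∣b∣*g≡D (ℕP.m≤n*m (suc k) ℤ.∣ b ∣))
  where
  instance
    _ : ℤ.NonZero b
    _ = ℤ.≢-nonZero {b} λ { refl → ℕ.≢-nonZero⁻¹ D (ℤP.+-injective (sym bg≡D)) }
  ∣b∣*g≡D : ℤ.∣ b ∣ ℕ.* suc k ≡ D
  ∣b∣*g≡D = trans (sym (ℤP.abs-* b +[1+ k ])) (cong ℤ.∣_∣ bg≡D)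

first-column-facts : ∀ {n} (D : ℕ) .{{_ : NonZero D}} (B M : Matrix (suc n) (suc n)) →
                     B *ᴹ M ≋ scalarᴹ (+ D) → FirstColumnReduced M →
                     0ℤ ℤ.< M zero zero × M zero zero ℤ.≤ + D × minor B *ᴹ minor M ≋ scalarᴹ (+ D)
first-column-facts D B M BM≋D (0≤g , below) = 0<g , g≤D , minor-inverse
  where
  g = M zero zero
  column₀ : ∀ i → (B *ᴹ M) i zero ≡ B i zero * g
  column₀ i = trans (cong (_+_ (B i zero * g)) (ᵥ*-zero-column (B i ∘ suc) (M ∘ suc) below)) (ℤP.+-identityʳ _)
  g-bounds = divisor-bound {b = B zero zero} D 0≤g
               (trans (sym (column₀ zero)) (trans (BM≋D zero zero) (ℤP.*-identityʳ (+ D))))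
  0<g = proj₁ g-bounds
  g≤D = proj₂ g-bounds
  B-below : ∀ k → B (suc k) zero ≡ 0ℤ
  B-below k = ℤP.*-cancelʳ-≡ (B (suc k) zero) 0ℤ g {{ℤ.>-nonZero 0<g}}
                (trans (sym (column₀ (suc k))) (trans (BM≋D (suc k) zero) (ℤP.*-zeroʳ (+ D))))
  minor-inverse : minor B *ᴹ minor M ≋ scalarᴹ (+ D)
  minor-inverse k l = begin
    (minor B *ᴹ minor M) k l                   ≡⟨ ℤP.+-identityˡ _ ⟨
    0ℤ + (minor B *ᴹ minor M) k l              ≡⟨ cong (_+ BM′) (ℤP.*-zeroˡ (M zero (suc l))) ⟨
    0ℤ * M zero (suc l) + BM′                  ≡⟨ cong (λ z → z * M zero (suc l) + BM′) (B-below k) ⟨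
    (B *ᴹ M) (suc k) (suc l)                   ≡⟨ BM≋D (suc k) (suc l) ⟩
    scalarᴹ (+ D) k l                          ∎
    where
    open ≡-Reasoning
    BM′ = (minor B *ᴹ minor M) k l

left-inverse-transport : ∀ {n} (x : ℤ) (B M E E⁻¹ : Matrix n n) → E⁻¹ *ᴹ E ≋ 1ᴹ → B *ᴹ M ≋ scalarᴹ x →
                         (B *ᴹ E⁻¹) *ᴹ (E *ᴹ M) ≋ scalarᴹ x
left-inverse-transport {n} x B M E E⁻¹ E⁻¹E≋1 BM≋x = begin
  (B *ᴹ E⁻¹) *ᴹ (E *ᴹ M) ≈⟨ *ᴹ-assoc B E⁻¹ (E *ᴹ M) ⟩
  B *ᴹ (E⁻¹ *ᴹ (E *ᴹ M)) ≈⟨ *ᴹ-congʳ B (*ᴹ-assoc E⁻¹ E M) ⟨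
  B *ᴹ ((E⁻¹ *ᴹ E) *ᴹ M) ≈⟨ *ᴹ-congʳ B (*ᴹ-congˡ M E⁻¹E≋1) ⟩
  B *ᴹ (1ᴹ *ᴹ M)         ≈⟨ *ᴹ-congʳ B (*ᴹ-identityˡ M) ⟩
  B *ᴹ M                 ≈⟨ BM≋x ⟩
  scalarᴹ x              ∎
  where open SetoidReasoning (≋-setoid n n)

-- B is only needed to bound the diagonal: B *ᴹ M ≋ D·1 makes every pivot divide D.
hermite : ∀ {n} (D : ℕ) .{{_ : NonZero D}} (M B : Matrix n n) → B *ᴹ M ≋ scalarᴹ (+ D) → HermiteForm D M
hermite {zero}  D M B _ = record
  { U = 1ᴹ ; U-unimodular = 1ᴹ-unimodular ; H = M ; H≋U*M = λ () ; H-hermite = tt ; H-diagonal≤D = λ () }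
hermite {suc n} D M B BM≋D =
  hermite-form-absorbˡ {E = E} {M = M} E-unimodular
    (hermite-extend D (E *ᴹ M) (proj₂ reduced) 0<g g≤D (hermite D (minor (E *ᴹ M)) (minor (B *ᴹ E⁻¹)) minor-inverse))
  where
  first = reduce-first-column M
  E = proj₁ first
  E-unimodular = proj₁ (proj₂ first)
  reduced = proj₂ (proj₂ first)
  E⁻¹ = proj₁ E-unimodular
  facts = first-column-facts D (B *ᴹ E⁻¹) (E *ᴹ M)
            (left-inverse-transport (+ D) B M E E⁻¹ (proj₂ (proj₂ E-unimodular)) BM≋D) reduced
  0<g = proj₁ facts
  g≤D = proj₁ (proj₂ facts)
  minor-inverse = proj₂ (proj₂ facts)

-- An integer inverse up to a scalar

RowDependency : ∀ {m n} → Matrix m n → Set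
RowDependency {m} A = Σ (Vector ℤ m) λ c → (Σ (Fin m) λ k → c k ≢ 0ℤ) × c ᵥ* A ≗ 0ᵥ

LinearlyIndependent : ∀ {m n} → Matrix m n → Set
LinearlyIndependent {m} A = ∀ (c : Vector ℤ m) → c ᵥ* A ≗ 0ᵥ → ∀ k → c k ≡ 0ℤ

pivot-eliminate : ∀ {m n} → Fin (suc m) → Matrix (suc m) (suc n) → Matrix m n
pivot-eliminate i A k j = A i zero * A (punchIn i k) (suc j) - A (punchIn i k) zero * A i (suc j)

pivot-eliminate-ᵥ* : ∀ {m n} (i : Fin (suc m)) (A : Matrix (suc m) (suc n)) (c : Vector ℤ m) j →
                     (c ᵥ* pivot-eliminate i A) j
                       ≡ A i zero * (c ᵥ* (A ∘ punchIn i)) (suc j) + - A i (suc j) * (c ᵥ* (A ∘ punchIn i)) zero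
pivot-eliminate-ᵥ* i A c j = begin
  (c ᵥ* pivot-eliminate i A) j
    ≡⟨ sum-cong-≗ (λ k → distribute (c k) p (Aᵢ k (suc j)) (Aᵢ k zero) w) ⟩
  sum (λ k → p * (c k * Aᵢ k (suc j)) + - w * (c k * Aᵢ k zero))
    ≡⟨ ∑-distrib-+ (λ k → p * (c k * Aᵢ k (suc j))) (λ k → - w * (c k * Aᵢ k zero)) ⟩
  sum (λ k → p * (c k * Aᵢ k (suc j))) + sum (λ k → - w * (c k * Aᵢ k zero))
    ≡⟨ cong₂ _+_ (*-distribˡ-sum p (λ k → c k * Aᵢ k (suc j))) (*-distribˡ-sum (- w) (λ k → c k * Aᵢ k zero)) ⟨
  p * (c ᵥ* Aᵢ) (suc j) + - w * (c ᵥ* Aᵢ) zero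
    ∎
  where
  open ≡-Reasoning
  p = A i zero
  w = A i (suc j)
  Aᵢ = A ∘ punchIn i
  distribute : ∀ c p a b w → c * (p * a - b * w) ≡ p * (c * a) + - w * (c * b)
  distribute = solve-∀

pivot-lift : ∀ {m n} (i : Fin (suc m)) (A : Matrix (suc m) (suc n)) → A i zero ≢ 0ℤ →
             RowDependency (pivot-eliminate i A) → RowDependency A
pivot-lift i A p≢0 (c , (k , cₖ≢0) , c-kills) = c′ , (punchIn i k , c′ₖ≢0) , c′-kills
  where
  p = A i zero
  Aᵢ = A ∘ punchIn i
  X = (c ᵥ* Aᵢ) zero
  c′ = insertAt (λ k → p * c k) i (- X)
  c′ₖ≢0 : c′ (punchIn i k) ≢ 0ℤ
  c′ₖ≢0 c′ₖ≡0 with ℤP.i*j≡0⇒i≡0∨j≡0 p (trans (sym (insertAt-punchIn (λ k → p * c k) i (- X) k)) c′ₖ≡0)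
  ... | inj₁ p≡0  = p≢0 p≡0
  ... | inj₂ cₖ≡0 = cₖ≢0 cₖ≡0
  split : ∀ j → (c′ ᵥ* A) j ≡ - X * A i j + p * (c ᵥ* Aᵢ) j
  split j = begin
    (c′ ᵥ* A) j                                ≡⟨ sum-remove {i = i} (λ k → c′ k * A k j) ⟩
    c′ i * A i j + ((c′ ∘ punchIn i) ᵥ* Aᵢ) j   ≡⟨ cong₂ (λ x y → x * A i j + y)
                                                         (insertAt-lookup (λ k → p * c k) i (- X))
                                                         (ᵥ*-congˡ Aᵢ (insertAt-punchIn (λ k → p * c k) i (- X)) j) ⟩
    - X * A i j + ((λ k → p * c k) ᵥ* Aᵢ) j     ≡⟨ cong (_+_ (- X * A i j)) (ᵥ*-scaleˡ p c Aᵢ j) ⟩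
    - X * A i j + p * (c ᵥ* Aᵢ) j               ∎
    where open ≡-Reasoning
  cancel : ∀ x p → - x * p + p * x ≡ 0ℤ
  cancel = solve-∀
  reorder : ∀ x w p y → - x * w + p * y ≡ p * y + - w * x
  reorder = solve-∀
  c′-kills : c′ ᵥ* A ≗ 0ᵥ
  c′-kills zero    = trans (split zero) (cancel X p)
  c′-kills (suc j) = begin
    (c′ ᵥ* A) (suc j)                                  ≡⟨ split (suc j) ⟩
    - X * A i (suc j) + p * (c ᵥ* Aᵢ) (suc j)          ≡⟨ reorder X (A i (suc j)) p ((c ᵥ* Aᵢ) (suc j)) ⟩
    p * (c ᵥ* Aᵢ) (suc j) + - A i (suc j) * X          ≡⟨ pivot-eliminate-ᵥ* i A c j ⟨
    (c ᵥ* pivot-eliminate i A) j                       ≡⟨ c-kills j ⟩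
    0ℤ                                                 ∎
    where open ≡-Reasoning

dependent : ∀ {m n} → n ℕ.< m → (A : Matrix m n) → RowDependency A
dependent {suc m} {zero}  _           A = (λ _ → 1ℤ) , (zero , λ ()) , λ ()
dependent {suc m} {suc n} (ℕ.s≤s n<m) A with FinP.all? (λ i → A i zero ℤ.≟ 0ℤ)
... | yes column₀≡0 with dependent (ℕP.m<n⇒m<1+n n<m) (λ i j → A i (suc j))
...   | c , nonzero , c-kills = c , nonzero , λ { zero → ᵥ*-zero-column c A column₀≡0 ; (suc j) → c-kills j }
dependent {suc m} {suc n} (ℕ.s≤s n<m) A | no ¬column₀≡0 with FinP.¬∀⟶∃¬ (suc m) _ (λ i → A i zero ℤ.≟ 0ℤ) ¬column₀≡0
... | i , pivot≢0 = pivot-lift i A pivot≢0 (dependent n<m (pivot-eliminate i A))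

independent⇒ᵥ*-injective : ∀ {m n} {A : Matrix m n} → LinearlyIndependent A → ∀ c c′ → c ᵥ* A ≗ c′ ᵥ* A → c ≗ c′
independent⇒ᵥ*-injective {A = A} independent c c′ cA≗c′A k =
  ℤP.i-j≡0⇒i≡j (c k) (c′ k) (independent (λ k → c k - c′ k) difference-kills k)
  where
  difference-kills : (λ k → c k - c′ k) ᵥ* A ≗ 0ᵥ
  difference-kills j = begin
    ((λ k → c k - c′ k) ᵥ* A) j          ≡⟨ ᵥ*-distrib-+ c (λ k → - c′ k) A j ⟩
    (c ᵥ* A) j + ((λ k → - c′ k) ᵥ* A) j ≡⟨ cong₂ _+_ (cA≗c′A j) (ᵥ*-neg c′ A j) ⟩
    (c′ ᵥ* A) j - (c′ ᵥ* A) j            ≡⟨ ℤP.+-inverseʳ ((c′ ᵥ* A) j) ⟩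
    0ℤ                                   ∎
    where open ≡-Reasoning

right-inverse : ∀ {n} (x : ℤ) (v Z : Matrix n n) → LinearlyIndependent v → Z *ᴹ v ≋ scalarᴹ x → v *ᴹ Z ≋ scalarᴹ x
right-inverse x v Z independent Zv≋x l =
  independent⇒ᵥ*-injective independent ((v *ᴹ Z) l) (scalarᴹ x l) same-combination
  where
  same-combination : (v *ᴹ Z) l ᵥ* v ≗ scalarᴹ x l ᵥ* v
  same-combination k = begin
    ((v *ᴹ Z) l ᵥ* v) k       ≡⟨ ᵥ*-assoc (v l) Z v k ⟩
    (v *ᴹ (Z *ᴹ v)) l k       ≡⟨ *ᴹ-congʳ v Zv≋x l k ⟩
    (v *ᴹ scalarᴹ x) l k      ≡⟨ *ᴹ-scalarᴹ x v l k ⟩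
    x * v l k                 ≡⟨ scalarᴹ-*ᴹ x v l k ⟨
    (scalarᴹ x *ᴹ v) l k      ∎
    where open ≡-Reasoning

unit-multiple : ∀ {n} (v : Matrix n n) → LinearlyIndependent v → ∀ j →
                Σ ℤ λ x → x ≢ 0ℤ × Σ (Vector ℤ n) λ z → z ᵥ* v ≗ λ l → x * 1ᴹ j l
unit-multiple {n} v independent j with dependent (ℕP.n<1+n n) (1ᴹ j ◂ v)
... | c , (k , cₖ≢0) , c-kills = - c zero , c₀≢0 ∘ ⁻¹-injective , c ∘ suc , combination
  where
  combination : (c ∘ suc) ᵥ* v ≗ λ l → - c zero * 1ᴹ j l
  combination l = trans (inverseʳ-unique (c zero * 1ᴹ j l) _ (c-kills l)) (ℤP.neg-distribˡ-* (c zero) (1ᴹ j l))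
  c₀≢0 : c zero ≢ 0ℤ
  c₀≢0 c₀≡0 = cₖ≢0 (all-zero k)
    where
    all-zero : ∀ k → c k ≡ 0ℤ
    all-zero zero    = c₀≡0
    all-zero (suc k) = independent (c ∘ suc) (λ l → trans (combination l) (trans (cong (λ x → - x * 1ᴹ j l) c₀≡0)
                                                                                 (ℤP.*-zeroˡ (1ᴹ j l)))) k

product-nonzero : ∀ {n} (x : Vector ℤ n) → (∀ j → x j ≢ 0ℤ) → product x ≢ 0ℤ
product-nonzero {zero}  x _   ()
product-nonzero {suc n} x x≢0 Πx≡0 with ℤP.i*j≡0⇒i≡0∨j≡0 (x zero) Πx≡0
... | inj₁ x₀≡0 = x≢0 zero x₀≡0
... | inj₂ Π≡0  = product-nonzero (x ∘ suc) (x≢0 ∘ suc) Π≡0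

record ScaledInverse {n} (v : Matrix n n) : Set where
  field
    D      : ℕ
    D≢0    : NonZero D
    Z      : Matrix n n
    Z*v≋D  : Z *ᴹ v ≋ scalarᴹ (+ D)

-- With z_j v = x_j e_j, scaling z_j by the product of the other x_i and a common sign s
-- gives Z v = D·1 for D = |s ∏ x_i|.
scaled-inverse : ∀ {n} (v : Matrix n n) → LinearlyIndependent v → ScaledInverse v
scaled-inverse {zero}  v independent = record { D = 1 ; D≢0 = _ ; Z = λ () ; Z*v≋D = λ () }
scaled-inverse {suc n} v independent with sign-normaliser (product (λ j → proj₁ (unit-multiple v independent j)))
... | s , s²≡1 , 0≤sP = record { D = ℤ.∣ s * P ∣ ; D≢0 = ℕ.≢-nonZero sP≢0 ; Z = Z ; Z*v≋D = Z*v≋D }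
  where
  multiple = unit-multiple v independent
  x = λ j → proj₁ (multiple j)
  z = λ j → proj₁ (proj₂ (proj₂ (multiple j)))
  P = product x
  sP≢0 : ℤ.∣ s * P ∣ ≢ 0
  sP≢0 ∣sP∣≡0 = product-nonzero x (λ j → proj₁ (proj₂ (multiple j))) (begin
    P             ≡⟨ ℤP.*-identityˡ P ⟨
    1ℤ * P        ≡⟨ cong (_* P) s²≡1 ⟨
    s * s * P     ≡⟨ ℤP.*-assoc s s P ⟩
    s * (s * P)   ≡⟨ cong (s *_) (ℤP.∣i∣≡0⇒i≡0 ∣sP∣≡0) ⟩
    s * 0ℤ        ≡⟨ ℤP.*-zeroʳ s ⟩
    0ℤ            ∎)
    where open ≡-Reasoning
  cofactor = λ j → s * product (removeAt x j)
  Z : Matrix (suc n) (suc n)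
  Z j k = cofactor j * z j k
  regroup : ∀ s y x δ → s * y * (x * δ) ≡ s * (x * y) * δ
  regroup = solve-∀
  Z*v≋D : Z *ᴹ v ≋ scalarᴹ (+ ℤ.∣ s * P ∣)
  Z*v≋D j l = begin
    (Z *ᴹ v) j l                                   ≡⟨ ᵥ*-scaleˡ (cofactor j) (z j) v l ⟩
    cofactor j * (z j ᵥ* v) l                      ≡⟨ cong (cofactor j *_) (proj₂ (proj₂ (proj₂ (multiple j))) l) ⟩
    s * product (removeAt x j) * (x j * 1ᴹ j l)    ≡⟨ regroup s (product (removeAt x j)) (x j) (1ᴹ j l) ⟩
    s * (x j * product (removeAt x j)) * 1ᴹ j l    ≡⟨ cong (λ y → s * y * 1ᴹ j l) (product-remove {i = j} x) ⟨
    s * P * 1ᴹ j l                                 ≡⟨ cong (_* 1ᴹ j l) (ℤP.0≤i⇒+∣i∣≡i 0≤sP) ⟨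
    + ℤ.∣ s * P ∣ * 1ᴹ j l                         ∎
    where open ≡-Reasoning


-- Convex hulls of cubes

-- toℚ z and i ℚ./ suc n are, by definition, fromℚᵘ (mkℚᵘ z 0) and fromℚᵘ (mkℚᵘ i n).
fromℚᵘ-homo-+ : ∀ p q → fromℚᵘ (p ℚᵘ.+ q) ≡ fromℚᵘ p ℚ.+ fromℚᵘ q
fromℚᵘ-homo-+ p q = ℚP.toℚᵘ-injective (ℚᵘP.≃-trans (ℚP.toℚᵘ-fromℚᵘ (p ℚᵘ.+ q)) (ℚᵘP.≃-sym
  (ℚᵘP.≃-trans (ℚP.toℚᵘ-homo-+ (fromℚᵘ p) (fromℚᵘ q)) (ℚᵘP.+-cong (ℚP.toℚᵘ-fromℚᵘ p) (ℚP.toℚᵘ-fromℚᵘ q)))))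

fromℚᵘ-homo-* : ∀ p q → fromℚᵘ (p ℚᵘ.* q) ≡ fromℚᵘ p ℚ.* fromℚᵘ q
fromℚᵘ-homo-* p q = ℚP.toℚᵘ-injective (ℚᵘP.≃-trans (ℚP.toℚᵘ-fromℚᵘ (p ℚᵘ.* q)) (ℚᵘP.≃-sym
  (ℚᵘP.≃-trans (ℚP.toℚᵘ-homo-* (fromℚᵘ p) (fromℚᵘ q)) (ℚᵘP.*-cong (ℚP.toℚᵘ-fromℚᵘ p) (ℚP.toℚᵘ-fromℚᵘ q)))))

toℚ-+ : ∀ a b → toℚ (a + b) ≡ toℚ a ℚ.+ toℚ b
toℚ-+ a b = trans (ℚP.fromℚᵘ-cong {mkℚᵘ (a + b) 0} {mkℚᵘ a 0 ℚᵘ.+ mkℚᵘ b 0} (*≡* (identity a b)))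
                  (fromℚᵘ-homo-+ (mkℚᵘ a 0) (mkℚᵘ b 0))
  where
  identity : ∀ a b → (a + b) * 1ℤ ≡ (a * 1ℤ + b * 1ℤ) * 1ℤ
  identity = solve-∀

toℚ-* : ∀ a b → toℚ (a * b) ≡ toℚ a ℚ.* toℚ b
toℚ-* a b = fromℚᵘ-homo-* (mkℚᵘ a 0) (mkℚᵘ b 0)

toℚ-injective : ∀ {a b} → toℚ a ≡ toℚ b → a ≡ b
toℚ-injective {a} {b} eq with ℚP.fromℚᵘ-injective {mkℚᵘ a 0} {mkℚᵘ b 0} eq
... | *≡* a*1≡b*1 = trans (sym (ℤP.*-identityʳ a)) (trans a*1≡b*1 (ℤP.*-identityʳ b))

toℚ-sumℤ : ∀ {n} (f : Fin n → ℤ) → toℚ (sumℤ f) ≡ sumℚ (λ i → toℚ (f i))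
toℚ-sumℤ {zero}  f = refl
toℚ-sumℤ {suc n} f = trans (toℚ-+ (f zero) _) (cong (toℚ (f zero) ℚ.+_) (toℚ-sumℤ (f ∘ suc)))

/-split : ∀ i N .{{_ : NonZero N}} → i ℚ./ N ≡ toℚ i ℚ.* (1ℤ ℚ./ N)
/-split i (suc N) = trans (ℚP.fromℚᵘ-cong {mkℚᵘ i N} {mkℚᵘ i 0 ℚᵘ.* mkℚᵘ 1ℤ N} (*≡* (identity i (+ suc N))))
                          (fromℚᵘ-homo-* (mkℚᵘ i 0) (mkℚᵘ 1ℤ N))
  where
  identity : ∀ i n → i * (1ℤ * n) ≡ (i * 1ℤ) * n
  identity = solve-∀

toℚ-*-1/ : ∀ N .{{_ : NonZero N}} → toℚ (+ N) ℚ.* (1ℤ ℚ./ N) ≡ 1ℚ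
toℚ-*-1/ (suc N) = trans (sym (fromℚᵘ-homo-* (mkℚᵘ (+ suc N) 0) (mkℚᵘ 1ℤ N)))
                         (ℚP.fromℚᵘ-cong {mkℚᵘ (+ suc N) 0 ℚᵘ.* mkℚᵘ 1ℤ N} {mkℚᵘ 1ℤ 0} (*≡* (identity (+ suc N))))
  where
  identity : ∀ n → (n * 1ℤ) * 1ℤ ≡ 1ℤ * (1ℤ * n)
  identity = solve-∀

/-nonNeg : ∀ {i} N .{{_ : NonZero N}} → 0ℤ ℤ.≤ i → 0ℚ ℚ.≤ i ℚ./ N
/-nonNeg {i} (suc N) 0≤i = ℚP.toℚᵘ-cancel-≤ (ℚᵘP.≤-respʳ-≃ (ℚᵘP.≃-sym (ℚP.toℚᵘ-fromℚᵘ (mkℚᵘ i N)))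
  (*≤* (subst₂ ℤ._≤_ (sym (ℤP.*-zeroˡ (+ suc N))) (sym (ℤP.*-identityʳ i)) 0≤i)))

/-≤1 : ∀ {i} N .{{_ : NonZero N}} → i ℤ.≤ + N → i ℚ./ N ℚ.≤ 1ℚ
/-≤1 {i} (suc N) i≤N = ℚP.toℚᵘ-cancel-≤ (ℚᵘP.≤-respˡ-≃ (ℚᵘP.≃-sym (ℚP.toℚᵘ-fromℚᵘ (mkℚᵘ i N)))
  (*≤* (subst₂ ℤ._≤_ (sym (ℤP.*-identityʳ i)) (sym (ℤP.*-identityˡ (+ suc N))) i≤N)))

sumℚ≡sum : ∀ {n} (f : Fin n → ℚ) → sumℚ f ≡ ∑ℚ.sum f
sumℚ≡sum {zero}  f = refl
sumℚ≡sum {suc n} f = cong (f zero ℚ.+_) (sumℚ≡sum (f ∘ suc))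

sumℚ-cong : ∀ {n} {f g : Fin n → ℚ} → (∀ i → f i ≡ g i) → sumℚ f ≡ sumℚ g
sumℚ-cong {f = f} {g} f≗g = trans (sumℚ≡sum f) (trans (∑ℚ.sum-cong-≗ f≗g) (sym (sumℚ≡sum g)))

*-distribˡ-sumℚ : ∀ {n} (c : ℚ) (f : Fin n → ℚ) → c ℚ.* sumℚ f ≡ sumℚ (λ i → c ℚ.* f i)
*-distribˡ-sumℚ c f = trans (cong (c ℚ.*_) (sumℚ≡sum f))
                             (trans (∑ℚ.*-distribˡ-sum c f) (sym (sumℚ≡sum (λ i → c ℚ.* f i))))

sumℚ-++ : ∀ {m n} (f : Vector ℚ m) (g : Vector ℚ n) → sumℚ (f ++ g) ≡ sumℚ f ℚ.+ sumℚ g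
sumℚ-++ {zero}  f g = sym (ℚP.+-identityˡ (sumℚ g))
sumℚ-++ {suc m} f g = begin
  f zero ℚ.+ sumℚ (λ i → (f ++ g) (suc i))          ≡⟨ cong (f zero ℚ.+_)
                                                             (sumℚ-cong (λ i → SumP.[,]-map (Fin.splitAt m i))) ⟩
  f zero ℚ.+ sumℚ ((f ∘ suc) ++ g)                  ≡⟨ cong (f zero ℚ.+_) (sumℚ-++ (f ∘ suc) g) ⟩
  f zero ℚ.+ (sumℚ (f ∘ suc) ℚ.+ sumℚ g)            ≡⟨ ℚP.+-assoc (f zero) _ (sumℚ g) ⟨
  sumℚ f ℚ.+ sumℚ g                                ∎
  where open ≡-Reasoning

++-all : ∀ {a p} {A : Set a} {P : A → Set p} {m n} (f : Vector A m) (g : Vector A n) →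
         (∀ i → P (f i)) → (∀ i → P (g i)) → ∀ i → P ((f ++ g) i)
++-all {m = m} f g Pf Pg i with Fin.splitAt m i
... | inj₁ k = Pf k
... | inj₂ k = Pg k

++-zipWith : ∀ {a b c} {A : Set a} {B : Set b} {C : Set c} {m n} (h : A → B → C)
             (f : Vector A m) (f′ : Vector A n) (g : Vector B m) (g′ : Vector B n) →
             ∀ i → h ((f ++ f′) i) ((g ++ g′) i) ≡ ((λ k → h (f k) (g k)) ++ (λ k → h (f′ k) (g′ k))) i
++-zipWith {m = m} h f f′ g g′ i with Fin.splitAt m i
... | inj₁ k = refl
... | inj₂ k = refl

0≤*0≤ : ∀ {p q} → 0ℚ ℚ.≤ p → 0ℚ ℚ.≤ q → 0ℚ ℚ.≤ p ℚ.* q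
0≤*0≤ {p} {q} 0≤p 0≤q =
  ℚP.nonNegative⁻¹ (p ℚ.* q) {{ℚP.nonNeg*nonNeg⇒nonNeg p {{ℚ.nonNegative 0≤p}} q {{ℚ.nonNegative 0≤q}}}}

0≤1-t : ∀ {t} → t ℚ.≤ 1ℚ → 0ℚ ℚ.≤ 1ℚ ℚ.- t
0≤1-t {t} t≤1 = subst (ℚ._≤ 1ℚ ℚ.- t) (ℚP.+-inverseʳ t) (ℚP.+-monoˡ-≤ (ℚ.- t) t≤1)

-- InConvHull S p is InHull S (toℚ ∘ p) by definition.
InHull : ∀ {d} → (Pt d → Set) → (Fin d → ℚ) → Set
InHull {d} S q =
  Σ ℕ λ n → Σ (Fin n → ℚ) λ λs → Σ (Fin n → Pt d) λ x →
    (∀ m → S (x m)) × (∀ m → 0ℚ ℚ.≤ λs m) × (sumℚ λs ≡ 1ℚ) × (∀ j → sumℚ (λ m → λs m ℚ.* toℚ (x m j)) ≡ q j)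

hull-point : ∀ {d} {S : Pt d → Set} {x : Pt d} → S x → InHull S (λ j → toℚ (x j))
hull-point {x = x} x∈S = 1 , (λ _ → 1ℚ) , (λ _ → x) , (λ _ → x∈S) , (λ _ → ℚP.nonNegative⁻¹ 1ℚ) , refl ,
  λ j → trans (ℚP.+-identityʳ _) (ℚP.*-identityˡ _)

hull-cong : ∀ {d} {S : Pt d → Set} {q q′ : Fin d → ℚ} → (∀ j → q j ≡ q′ j) → InHull S q → InHull S q′
hull-cong q≗q′ (n , λs , x , x∈S , λs≥0 , ∑λs≡1 , combination) =
  n , λs , x , x∈S , λs≥0 , ∑λs≡1 , λ j → trans (combination j) (q≗q′ j)

hull-mono : ∀ {d} {S S′ : Pt d → Set} {q : Fin d → ℚ} → (∀ x → S x → S′ x) → InHull S q → InHull S′ q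
hull-mono S⊆S′ (n , λs , x , x∈S , rest) = n , λs , x , (λ m → S⊆S′ (x m) (x∈S m)) , rest

hull-convex : ∀ {d} {S : Pt d → Set} {q q′ : Fin d → ℚ} (t : ℚ) → 0ℚ ℚ.≤ t → t ℚ.≤ 1ℚ →
              InHull S q → InHull S q′ → InHull S (λ j → (1ℚ ℚ.- t) ℚ.* q j ℚ.+ t ℚ.* q′ j)
hull-convex {S = S} {q} {q′} t 0≤t t≤1 (n , λs , x , x∈S , λs≥0 , ∑λs≡1 , comb)
                                       (n′ , λs′ , x′ , x′∈S , λs′≥0 , ∑λs′≡1 , comb′) =
  n ℕ.+ n′ , μ ++ μ′ , x ++ x′ , ++-all {P = S} x x′ x∈S x′∈S ,
  ++-all {P = 0ℚ ℚ.≤_} μ μ′ (λ m → 0≤*0≤ (0≤1-t t≤1) (λs≥0 m)) (λ m → 0≤*0≤ 0≤t (λs′≥0 m)) , ∑μ≡1 , combination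
  where
  open ≡-Reasoning
  μ  = λ m → (1ℚ ℚ.- t) ℚ.* λs m
  μ′ = λ m → t ℚ.* λs′ m
  weighted : ∀ {k} (c : ℚ) (w y : Fin k → ℚ) → sumℚ (λ m → c ℚ.* w m ℚ.* y m) ≡ c ℚ.* sumℚ (λ m → w m ℚ.* y m)
  weighted c w y = trans (sumℚ-cong (λ m → ℚP.*-assoc c (w m) (y m))) (sym (*-distribˡ-sumℚ c (λ m → w m ℚ.* y m)))
  ∑μ≡1 : sumℚ (μ ++ μ′) ≡ 1ℚ
  ∑μ≡1 = begin
    sumℚ (μ ++ μ′)                               ≡⟨ sumℚ-++ μ μ′ ⟩
    sumℚ μ ℚ.+ sumℚ μ′                           ≡⟨ cong₂ ℚ._+_ (*-distribˡ-sumℚ (1ℚ ℚ.- t) λs)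
                                                                   (*-distribˡ-sumℚ t λs′) ⟨
    (1ℚ ℚ.- t) ℚ.* sumℚ λs ℚ.+ t ℚ.* sumℚ λs′   ≡⟨ cong₂ (λ a b → (1ℚ ℚ.- t) ℚ.* a ℚ.+ t ℚ.* b) ∑λs≡1 ∑λs′≡1 ⟩
    (1ℚ ℚ.- t) ℚ.* 1ℚ ℚ.+ t ℚ.* 1ℚ               ≡⟨ solve 1 (λ t → (con 1ℚ :- t) :* con 1ℚ :+ t :* con 1ℚ
                                                                   := con 1ℚ) refl t ⟩
    1ℚ                                           ∎
  combination : ∀ j → sumℚ (λ m → (μ ++ μ′) m ℚ.* toℚ ((x ++ x′) m j)) ≡ (1ℚ ℚ.- t) ℚ.* q j ℚ.+ t ℚ.* q′ j
  combination j = begin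
    sumℚ (λ m → (μ ++ μ′) m ℚ.* toℚ ((x ++ x′) m j))
      ≡⟨ sumℚ-cong (++-zipWith (λ w y → w ℚ.* toℚ (y j)) μ μ′ x x′) ⟩
    sumℚ ((λ m → μ m ℚ.* toℚ (x m j)) ++ (λ m → μ′ m ℚ.* toℚ (x′ m j)))
      ≡⟨ sumℚ-++ (λ m → μ m ℚ.* toℚ (x m j)) (λ m → μ′ m ℚ.* toℚ (x′ m j)) ⟩
    sumℚ (λ m → μ m ℚ.* toℚ (x m j)) ℚ.+ sumℚ (λ m → μ′ m ℚ.* toℚ (x′ m j))
      ≡⟨ cong₂ ℚ._+_ (weighted (1ℚ ℚ.- t) λs (λ m → toℚ (x m j))) (weighted t λs′ (λ m → toℚ (x′ m j))) ⟩
    (1ℚ ℚ.- t) ℚ.* sumℚ (λ m → λs m ℚ.* toℚ (x m j)) ℚ.+ t ℚ.* sumℚ (λ m → λs′ m ℚ.* toℚ (x′ m j))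
      ≡⟨ cong₂ (λ a b → (1ℚ ℚ.- t) ℚ.* a ℚ.+ t ℚ.* b) (comb j) (comb′ j) ⟩
    (1ℚ ℚ.- t) ℚ.* q j ℚ.+ t ℚ.* q′ j
      ∎

-- InCube a v r is InCubeN a v r by definition.
InCubeN : ∀ {d n} → Pt d → (Fin n → Pt d) → ℕ → Pt d → Set
InCubeN {n = n} a u r x = Σ (Fin n → ℕ) λ i → (∀ k → i k ℕ.≤ r) × (∀ j → a j + sumℤ (λ k → + i k * u k j) ≡ x j)

parallelepiped⊆hull : ∀ {d n} (a : Pt d) (u : Fin n → Pt d) (r : ℕ) (τ : Fin n → ℚ) →
                      (∀ l → 0ℚ ℚ.≤ τ l) → (∀ l → τ l ℚ.≤ 1ℚ) →
                      InHull (InCubeN a u r) (λ j → toℚ (a j) ℚ.+ sumℚ (λ l → τ l ℚ.* toℚ (+ r * u l j)))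
parallelepiped⊆hull {n = zero} a u r τ _ _ =
  hull-cong {S = InCubeN a u r} (λ j → sym (ℚP.+-identityʳ (toℚ (a j))))
    (hull-point {S = InCubeN a u r} {x = a} ((λ ()) , (λ ()) , λ j → ℤP.+-identityʳ (a j)))
parallelepiped⊆hull {d} {suc n} a u r τ 0≤τ τ≤1 =
  hull-cong {S = InCubeN a u r} split (hull-convex {S = InCubeN a u r} (τ zero) (0≤τ zero) (τ≤1 zero)
    (hull-mono near-face (parallelepiped⊆hull a  (u ∘ suc) r (τ ∘ suc) (0≤τ ∘ suc) (τ≤1 ∘ suc)))
    (hull-mono far-face  (parallelepiped⊆hull a′ (u ∘ suc) r (τ ∘ suc) (0≤τ ∘ suc) (τ≤1 ∘ suc))))
  where
  a′ : Pt d
  a′ j = a j + + r * u zero j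
  near-face : ∀ x → InCubeN a (u ∘ suc) r x → InCubeN a u r x
  near-face x (i , i≤r , x≡) = (0 ◂ i) , (λ { zero → ℕ.z≤n ; (suc k) → i≤r k }) ,
    λ j → trans (cong (_+_ (a j)) (ℤP.+-identityˡ _)) (x≡ j)
  far-face : ∀ x → InCubeN a′ (u ∘ suc) r x → InCubeN a u r x
  far-face x (i , i≤r , x≡) = (r ◂ i) , (λ { zero → ℕP.≤-refl ; (suc k) → i≤r k }) ,
    λ j → trans (sym (ℤP.+-assoc (a j) _ _)) (x≡ j)
  split : ∀ j → (1ℚ ℚ.- τ zero) ℚ.* (toℚ (a j) ℚ.+ sumℚ (λ l → τ (suc l) ℚ.* toℚ (+ r * u (suc l) j)))
                ℚ.+ τ zero ℚ.* (toℚ (a′ j) ℚ.+ sumℚ (λ l → τ (suc l) ℚ.* toℚ (+ r * u (suc l) j)))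
              ≡ toℚ (a j) ℚ.+ sumℚ (λ l → τ l ℚ.* toℚ (+ r * u l j))
  split j = trans (cong (λ z → (1ℚ ℚ.- τ zero) ℚ.* (toℚ (a j) ℚ.+ T) ℚ.+ τ zero ℚ.* (z ℚ.+ T))
                        (toℚ-+ (a j) (+ r * u zero j)))
                  (solve 4 (λ t A R T → (con 1ℚ :- t) :* (A :+ T) :+ t :* ((A :+ R) :+ T)
                                           := A :+ (t :* R :+ T)) refl (τ zero) (toℚ (a j)) (toℚ (+ r * u zero j)) T)
    where T = sumℚ (λ l → τ (suc l) ℚ.* toℚ (+ r * u (suc l) j))

IsRBasis⇒independent : ∀ {d} (v : Matrix d d) → IsRBasis v → LinearlyIndependent v
IsRBasis⇒independent v v-basis c c-kills = toℚ-injective ∘ v-basis (λ k → toℚ (c k)) rational-kills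
  where
  rational-kills : ∀ j → sumℚ (λ k → toℚ (c k) ℚ.* toℚ (v k j)) ≡ 0ℚ
  rational-kills j = begin
    sumℚ (λ k → toℚ (c k) ℚ.* toℚ (v k j)) ≡⟨ sumℚ-cong (λ k → toℚ-* (c k) (v k j)) ⟨
    sumℚ (λ k → toℚ (c k * v k j))         ≡⟨ toℚ-sumℤ (λ k → c k * v k j) ⟨
    toℚ (sumℤ (λ k → c k * v k j))         ≡⟨ cong toℚ (trans (sumℤ≡sum (λ k → c k * v k j)) (c-kills j)) ⟩
    0ℚ                                     ∎
    where open ≡-Reasoning

unimodular⇒IsZBasis : ∀ {d} (U : Matrix d d) → Unimodular U → IsZBasis U
unimodular⇒IsZBasis U (U⁻¹ , UU⁻¹≋1 , U⁻¹U≋1) = independent , spanning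
  where
  independent : ∀ c → (∀ j → sumℤ (λ k → c k * U k j) ≡ 0ℤ) → ∀ k → c k ≡ 0ℤ
  independent c c-kills k = begin
    c k                    ≡⟨ ᵥ*-identityʳ c k ⟨
    (c ᵥ* 1ᴹ) k            ≡⟨ ᵥ*-congʳ c UU⁻¹≋1 k ⟨
    (c ᵥ* (U *ᴹ U⁻¹)) k    ≡⟨ ᵥ*-assoc c U U⁻¹ k ⟨
    ((c ᵥ* U) ᵥ* U⁻¹) k    ≡⟨ ᵥ*-congˡ U⁻¹ (λ j → trans (sym (sumℤ≡sum (λ k → c k * U k j))) (c-kills j)) k ⟩
    (0ᵥ ᵥ* U⁻¹) k          ≡⟨ ᵥ*-zeroˡ U⁻¹ k ⟩
    0ℤ                     ∎
    where open ≡-Reasoning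
  spanning : ∀ p → Σ (Vector ℤ _) λ c → ∀ j → sumℤ (λ k → c k * U k j) ≡ p j
  spanning p = p ᵥ* U⁻¹ , λ j → begin
    sumℤ (λ k → (p ᵥ* U⁻¹) k * U k j) ≡⟨ sumℤ≡sum (λ k → (p ᵥ* U⁻¹) k * U k j) ⟩
    ((p ᵥ* U⁻¹) ᵥ* U) j               ≡⟨ ᵥ*-assoc p U⁻¹ U j ⟩
    (p ᵥ* (U⁻¹ *ᴹ U)) j               ≡⟨ ᵥ*-congʳ p U⁻¹U≋1 j ⟩
    (p ᵥ* 1ᴹ) j                       ≡⟨ ᵥ*-identityʳ p j ⟩
    p j                               ∎
    where open ≡-Reasoning

sum-mono-≤ : ∀ {n} (f g : Vector ℤ n) → (∀ k → f k ℤ.≤ g k) → sum f ℤ.≤ sum g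
sum-mono-≤ {zero}  f g f≤g = ℤP.≤-refl
sum-mono-≤ {suc n} f g f≤g = ℤP.+-mono-≤ (f≤g zero) (sum-mono-≤ (f ∘ suc) (g ∘ suc) (f≤g ∘ suc))

sum-const : ∀ n c → sum {n} (λ _ → + c) ≡ + (n ℕ.* c)
sum-const zero    c = refl
sum-const (suc n) c = trans (cong (_+_ (+ c)) (sum-const n c)) (sym (ℤP.pos-+ c (n ℕ.* c)))

hermite-combination-bounds : ∀ {n} (D m : ℕ) (H : Matrix n n) → IsHermite H → (∀ k → H k k ℤ.≤ + D) →
                             (ι : Fin n → ℕ) → (∀ k → ι k ℕ.≤ m) →
                             ∀ l → 0ℤ ℤ.≤ ((λ k → + ι k) ᵥ* H) l × ((λ k → + ι k) ᵥ* H) l ℤ.≤ + (n ℕ.* (m ℕ.* D))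
hermite-combination-bounds {n} D m H hermite diagonal≤D ι ι≤m l =
  subst (ℤ._≤ ((λ k → + ι k) ᵥ* H) l) (sum-replicate-zero n) (sum-mono-≤ 0ᵥ (λ k → + ι k * H k l) term-nonNeg) ,
  subst (((λ k → + ι k) ᵥ* H) l ℤ.≤_) (sum-const n (m ℕ.* D))
        (sum-mono-≤ (λ k → + ι k * H k l) (λ _ → + (m ℕ.* D)) term-bounded)
  where
  entry = hermite-entry-bounds H hermite
  term-nonNeg : ∀ k → 0ℤ ℤ.≤ + ι k * H k l
  term-nonNeg k = subst (ℤ._≤ + ι k * H k l) (ℤP.*-zeroˡ (H k l))
                        (ℤP.*-monoʳ-≤-nonNeg (H k l) {{ℤ.nonNegative (proj₁ (entry k l))}} {0ℤ} {+ ι k} (ℤ.+≤+ ℕ.z≤n))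
  term-bounded : ∀ k → + ι k * H k l ℤ.≤ + (m ℕ.* D)
  term-bounded k = begin
    + ι k * H k l ≤⟨ ℤP.*-monoˡ-≤-nonNeg (+ ι k) (ℤP.≤-trans (proj₂ (entry k l)) (diagonal≤D l)) ⟩
    + ι k * + D   ≤⟨ ℤP.*-monoʳ-≤-nonNeg (+ D) (ℤ.+≤+ (ι≤m k)) ⟩
    + m * + D     ≡⟨ ℤP.pos-* m D ⟨
    + (m ℕ.* D)   ∎
    where open ℤP.≤-Reasoning

rescale : ∀ {n} (N : ℕ) .{{_ : NonZero N}} (S w : Vector ℤ n) (y : ℤ) → sum (λ l → S l * w l) ≡ + N * y →
          sumℚ (λ l → (S l ℚ./ N) ℚ.* toℚ (w l)) ≡ toℚ y
rescale N S w y Sw≡Ny = begin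
  sumℚ (λ l → (S l ℚ./ N) ℚ.* toℚ (w l))   ≡⟨ sumℚ-cong (λ l → factor (S l) (w l)) ⟩
  sumℚ (λ l → 1/N ℚ.* toℚ (S l * w l))     ≡⟨ *-distribˡ-sumℚ 1/N (λ l → toℚ (S l * w l)) ⟨
  1/N ℚ.* sumℚ (λ l → toℚ (S l * w l))     ≡⟨ cong (1/N ℚ.*_) (toℚ-sumℤ (λ l → S l * w l)) ⟨
  1/N ℚ.* toℚ (sumℤ (λ l → S l * w l))     ≡⟨ cong (λ z → 1/N ℚ.* toℚ z) (trans (sumℤ≡sum (λ l → S l * w l)) Sw≡Ny) ⟩
  1/N ℚ.* toℚ (+ N * y)                    ≡⟨ cong (1/N ℚ.*_) (toℚ-* (+ N) y) ⟩
  1/N ℚ.* (toℚ (+ N) ℚ.* toℚ y)            ≡⟨ solve 3 (λ u n y → u :* (n :* y) := (n :* u) :* y) refl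
                                                      1/N (toℚ (+ N)) (toℚ y) ⟩
  toℚ (+ N) ℚ.* 1/N ℚ.* toℚ y              ≡⟨ cong (ℚ._* toℚ y) (toℚ-*-1/ N) ⟩
  1ℚ ℚ.* toℚ y                             ≡⟨ ℚP.*-identityˡ (toℚ y) ⟩
  toℚ y                                    ∎
  where
  open ≡-Reasoning
  1/N = 1ℤ ℚ./ N
  factor : ∀ s x → (s ℚ./ N) ℚ.* toℚ x ≡ 1/N ℚ.* toℚ (s * x)
  factor s x = begin
    (s ℚ./ N) ℚ.* toℚ x          ≡⟨ cong (ℚ._* toℚ x) (/-split s N) ⟩
    toℚ s ℚ.* 1/N ℚ.* toℚ x      ≡⟨ solve 3 (λ s u x → (s :* u) :* x := u :* (s :* x)) refl (toℚ s) 1/N (toℚ x) ⟩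
    1/N ℚ.* (toℚ s ℚ.* toℚ x)    ≡⟨ cong (1/N ℚ.*_) (toℚ-* s x) ⟨
    1/N ℚ.* toℚ (s * x)          ∎

rows-rescaled : ∀ {d} (D r : ℕ) (v U H : Matrix d d) → H *ᴹ v ≋ + D ·ᴹ U → (c : Vector ℤ d) →
                ∀ j → sum (λ l → (c ᵥ* H) l * (+ r * v l j)) ≡ + (r ℕ.* D) * (c ᵥ* U) j
rows-rescaled D r v U H Hv≋DU c j = begin
  sum (λ l → (c ᵥ* H) l * (+ r * v l j))   ≡⟨ sum-cong-≗ (λ l → x∙yz≈y∙xz ((c ᵥ* H) l) (+ r) (v l j)) ⟩
  sum (λ l → + r * ((c ᵥ* H) l * v l j))   ≡⟨ *-distribˡ-sum (+ r) (λ l → (c ᵥ* H) l * v l j) ⟨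
  + r * ((c ᵥ* H) ᵥ* v) j                  ≡⟨ cong (_*_ (+ r)) (ᵥ*-assoc c H v j) ⟩
  + r * (c ᵥ* (H *ᴹ v)) j                  ≡⟨ cong (_*_ (+ r)) (ᵥ*-congʳ c Hv≋DU j) ⟩
  + r * (c ᵥ* (+ D ·ᴹ U)) j                ≡⟨ cong (_*_ (+ r)) (ᵥ*-scaleʳ (+ D) c U j) ⟩
  + r * (+ D * (c ᵥ* U) j)                 ≡⟨ ℤP.*-assoc (+ r) (+ D) _ ⟨
  + r * + D * (c ᵥ* U) j                   ≡⟨ cong (_* (c ᵥ* U) j) (ℤP.pos-* r D) ⟨
  + (r ℕ.* D) * (c ᵥ* U) j                 ∎
  where open ≡-Reasoning

cube⊆hull : ∀ {d} (D m r : ℕ) .{{_ : NonZero D}} .{{_ : NonZero r}} → d ℕ.* m ℕ.≤ r →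
            (a : Pt d) (v U H : Matrix d d) → IsHermite H → (∀ k → H k k ℤ.≤ + D) → H *ᴹ v ≋ + D ·ᴹ U →
            ∀ x → InCube a U m x → InConvHull (InCube a v r) x
cube⊆hull {d} D m r dm≤r a v U H hermite diagonal≤D Hv≋DU x (ι , ι≤m , x≡) =
  hull-cong {S = InCube a v r} x-as-combination (parallelepiped⊆hull a v r τ τ≥0 τ≤1)
  where
  instance
    _ : NonZero (r ℕ.* D)
    _ = ℕP.m*n≢0 r D
  N = r ℕ.* D
  ι′ = λ k → + ι k
  S = ι′ ᵥ* H
  τ = λ l → S l ℚ./ N
  bounds = hermite-combination-bounds D m H hermite diagonal≤D ι ι≤m
  τ≥0 : ∀ l → 0ℚ ℚ.≤ τ l
  τ≥0 l = /-nonNeg N (proj₁ (bounds l))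
  τ≤1 : ∀ l → τ l ℚ.≤ 1ℚ
  τ≤1 l = /-≤1 N (ℤP.≤-trans (proj₂ (bounds l)) (ℤ.+≤+ (subst (ℕ._≤ N) (ℕP.*-assoc d m D) (ℕP.*-monoˡ-≤ D dm≤r))))
  y : Fin d → ℤ
  y j = sumℤ (λ k → ι′ k * U k j)
  scaled : ∀ j → sum (λ l → S l * (+ r * v l j)) ≡ + N * y j
  scaled j = trans (rows-rescaled D r v U H Hv≋DU ι′ j) (cong (_*_ (+ N)) (sym (sumℤ≡sum (λ k → ι′ k * U k j))))
  x-as-combination : ∀ j → toℚ (a j) ℚ.+ sumℚ (λ l → τ l ℚ.* toℚ (+ r * v l j)) ≡ toℚ (x j)
  x-as-combination j = begin
    toℚ (a j) ℚ.+ sumℚ (λ l → τ l ℚ.* toℚ (+ r * v l j))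
      ≡⟨ cong (toℚ (a j) ℚ.+_) (rescale N S (λ l → + r * v l j) (y j) (scaled j)) ⟩
    toℚ (a j) ℚ.+ toℚ (y j)
      ≡⟨ toℚ-+ (a j) (y j) ⟨
    toℚ (a j + y j)
      ≡⟨ cong toℚ (x≡ j) ⟩
    toℚ (x j)
      ∎
    where open ≡-Reasoning

lemma3p2 : (d r : ℕ) → .{{_ : NonZero d}} → 0 < r →
    (a : Pt d) (v : Fin d → Pt d) → IsRBasis v →
    Σ (Pt d) λ b → Σ (Fin d → Pt d) λ w →
      IsZBasis w ×
      ((x : Pt d) → InCube b w (r / d) x → InConvHull (InCube a v r) x)
lemma3p2 d r 0<r a v v-basis =
  a , U , unimodular⇒IsZBasis U U-unimodular ,
  cube⊆hull D (r / d) r {{D≢0}} {{ℕ.>-nonZero 0<r}} d*[r/d]≤r a v U H H-hermite H-diagonal≤D Hv≋DU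
  where
  independent = IsRBasis⇒independent v v-basis
  open ScaledInverse (scaled-inverse v independent)
  open HermiteForm (hermite D {{D≢0}} Z v (right-inverse (+ D) v Z independent Z*v≋D))
  d*[r/d]≤r : d ℕ.* (r / d) ℕ.≤ r
  d*[r/d]≤r = subst (ℕ._≤ r) (ℕP.*-comm (r / d) d) (ℕD.m/n*n≤m r d)
  Hv≋DU : H *ᴹ v ≋ + D ·ᴹ U
  Hv≋DU = begin
    H *ᴹ v               ≈⟨ *ᴹ-congˡ v H≋U*M ⟩
    (U *ᴹ Z) *ᴹ v        ≈⟨ *ᴹ-assoc U Z v ⟩
    U *ᴹ (Z *ᴹ v)        ≈⟨ *ᴹ-congʳ U Z*v≋D ⟩
    U *ᴹ scalarᴹ (+ D)   ≈⟨ *ᴹ-scalarᴹ (+ D) U ⟩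
    + D ·ᴹ U             ∎
    where open SetoidReasoning (≋-setoid d d)
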